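{- Let $R>1$ be an integer all of whose prime factors $p$ satisfy $p\equiv 1\pmod 4$, and let $\tau(R)$ denote the number of positive divisors of $R$. Then there exists an integral point set over $\mathbb{Z}^2$ consisting of $2\tau(R)$ points lying on a circle of radius $\frac{R}{2}$.
   Context: An integral point set over $\mathbb{Z}^2$ is a finite set of points of $\mathbb{Z}^2$, not all on one line, such that the Euclidean distance between any two of its points is an integer. -}

module Defs where

open import Data.Nat as ℕ using (ℕ; suc)
open import Data.Nat.Divisibility using (_∣?_; _∣_)
open import Data.Nat.Primality using (Prime)
open import Data.Nat.DivMod using (_%_)
open import Data.Integer as ℤ using (ℤ; +_)
open import Data.List using (List; length; filter; upTo; map)
open import Data.Fin using (Fin)
open import Data.Product using (Σ; ∃; ∃-syntax; _×_; _,_)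
open import Function.Definitions using (Injective)
open import Relation.Binary.PropositionalEquality using (_≡_)
open import Relation.Nullary using (¬_)

Point : Set
Point = ℤ × ℤ

dist² : Point → Point → ℤ
dist² (x₁ , y₁) (x₂ , y₂) =
  ((x₁ ℤ.- x₂) ℤ.* (x₁ ℤ.- x₂)) ℤ.+ ((y₁ ℤ.- y₂) ℤ.* (y₁ ℤ.- y₂))

-- Euclidean distance between the points is an integer (it is ≥ 0, so a natural number)
IntegralDistance : Point → Point → Set
IntegralDistance p q = ∃[ d ] dist² p q ≡ + (d ℕ.* d)

Collinear : Point → Point → Point → Set
Collinear (x₁ , y₁) (x₂ , y₂) (x₃ , y₃) =
  (x₂ ℤ.- x₁) ℤ.* (y₃ ℤ.- y₁) ≡ (y₂ ℤ.- y₁) ℤ.* (x₃ ℤ.- x₁)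

-- A finite point set with n points, given as an injective enumeration Fin n → ℤ².
-- Integral point set: not all points on one line (some three are non-collinear)
-- and all pairwise distances integers.
IsIntegralPointSet : (n : ℕ) → (Fin n → Point) → Set
IsIntegralPointSet n P =
  Injective _≡_ _≡_ P
  × (∃[ i ] ∃[ j ] ∃[ k ] ¬ Collinear (P i) (P j) (P k))
  × (∀ i j → IntegralDistance (P i) (P j))

-- The centre is given as (a/q, b/q) with q > 0 (a circle through ≥ 3 non-collinear
-- lattice points necessarily has a rational centre). Condition, cleared of
-- denominators:  (q x - a)² + (q y - b)² = (q R / 2)²  ⇔  4[(qx-a)²+(qy-b)²] = q² R².
OnCircleRadiusHalf : (R : ℕ) (n : ℕ) → (Fin n → Point) → Set
OnCircleRadiusHalf R n P =
  ∃[ a ] ∃[ b ] ∃[ q ] (0 ℕ.< q) ×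
    (∀ i → let (x , y) = P i
               u = (+ q) ℤ.* x ℤ.- a
               v = (+ q) ℤ.* y ℤ.- b
           in + 4 ℤ.* (u ℤ.* u ℤ.+ v ℤ.* v) ≡ + (q ℕ.* q ℕ.* (R ℕ.* R)))

τ : ℕ → ℕ
τ R = length (filter (_∣? R) (map suc (upTo R)))

AllPrimeFactors1mod4 : ℕ → Set
AllPrimeFactors1mod4 R = ∀ p → Prime p → p ∣ R → p % 4 ≡ 1

module Submission where

-- Such an R is odd, R = 2ρ + 1. For a Gaussian integer γ = a + bi of norm R the
-- lattice point (1 + γ²)/2 = (ρ + 1 - b², ab) lies on the circle of radius R/2
-- around (1/2, 0), and for γ, δ of norm R the squared distance between their
-- points is (ad - bc)², a perfect square. It vanishes only if γ and δ are
-- associates, and for non-associate γ, δ the points of γ, iγ, δ are not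
-- collinear. So τ(R) pairwise non-associate Gaussian integers γⱼ of norm R give
-- the 2τ(R) points of γⱼ and iγⱼ.
--
-- The family is built by strong induction over R = p^k m with p ∤ m: Fermat's
-- two-square theorem (Zagier's involution proof) gives π = a + bi of norm p, the
-- products π^e π̄^(k-e) γⱼ are pairwise non-associate, and τ(p^k m) ≤ (k+1) τ(m).

module PrimeFacts where

  open import Data.Nat
  open import Data.Nat.Properties
  open import Data.Nat.Divisibility using (divides)
  open import Data.Nat.Primality using (Prime; prime⇒irreducible; prime⇒nonTrivial)
  open import Data.Sum using (inj₁; inj₂)
  open import Relation.Binary.PropositionalEquality
  open import Relation.Nullary.Negation using (contradiction)

  prime>1 : ∀ {p} → Prime p → 1 < p
  prime>1 {p} pr = nonTrivial⇒n>1 p {{prime⇒nonTrivial pr}}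

  -- A prime is not a perfect square: n ∣ n * n = p forces n = 1 or n = p.
  prime≢square : ∀ {p} → Prime p → ∀ n → p ≢ n * n
  prime≢square {p} pr n p≡n² with prime⇒irreducible pr (divides n p≡n²)
  ... | inj₁ refl = contradiction (subst (1 <_) p≡n² (prime>1 pr)) (λ { (s≤s ()) })
  ... | inj₂ n≡p = <⇒≢ (prime>1 pr) (sym (trans (sym n≡p) n≡1))
    where
    n≡1 : n ≡ 1
    n≡1 = *-cancelˡ-≡ n 1 p {{nonTrivial⇒nonZero p {{prime⇒nonTrivial pr}}}}
            (trans (sym (trans p≡n² (cong (_* n) n≡p))) (sym (*-identityʳ p)))

module InvolutionParity where

  open import Data.Nat using (ℕ; suc; _+_; _*_; _≤_; s≤s)
  open import Data.Nat.Properties using (≤-refl; ≤-trans; n≤1+n)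
  open import Data.List using (List; []; _∷_; length; filter)
  open import Data.List.Membership.Propositional using (_∈_; _∉_)
  open import Data.List.Membership.Propositional.Properties using (∈-filter⁺; ∈-filter⁻)
  open import Data.List.Relation.Unary.Any using (here; there)
  open import Data.List.Relation.Unary.AllPairs using (_∷_)
  open import Data.List.Relation.Unary.Unique.Propositional using (Unique)
  open import Data.List.Relation.Unary.Unique.Propositional.Properties using (filter⁺; Unique[x∷xs]⇒x∉xs)
  open import Data.Product using (∃; _,_; proj₁; proj₂)
  open import Relation.Binary.Definitions using (DecidableEquality)
  open import Relation.Binary.PropositionalEquality
  open import Relation.Nullary using (¬_; yes; no; ¬?)
  open import Relation.Nullary.Negation using (contradiction)
  open import Relation.Unary using (Decidable)
  open import Data.Nat.Tactic.RingSolver using (solve-∀)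

  -- An involution h of a finite set (a duplicate-free list closed under h) has
  -- as many points as fixed points, up to an even number: the non-fixed points
  -- fall into two-element orbits {x, h x}.
  module _ {A : Set} (_≟_ : DecidableEquality A) (h : A → A) where

    Fixed? : Decidable (λ x → h x ≡ x)
    Fixed? x = h x ≟ x

    fixedCount : List A → ℕ
    fixedCount xs = length (filter Fixed? xs)

    private
      ≢? : (a : A) → Decidable (λ y → ¬ y ≡ a)
      ≢? a y = ¬? (y ≟ a)

      without : A → List A → List A
      without a ys = filter (≢? a) ys

      without-∉ : ∀ a ys → a ∉ ys → length (without a ys) ≡ length ys
      without-∉ a [] _ = refl
      without-∉ a (y ∷ ys) a∉ with y ≟ a
      ... | no _ = cong suc (without-∉ a ys (λ m → a∉ (there m)))
      ... | yes y≡a = contradiction (here (sym y≡a)) a∉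

      without-∈ : ∀ a ys → a ∈ ys → Unique ys → suc (length (without a ys)) ≡ length ys
      without-∈ a (y ∷ ys) (here refl) u with y ≟ a
      ... | no y≢a = contradiction refl y≢a
      ... | yes _ = cong suc (without-∉ a ys (Unique[x∷xs]⇒x∉xs u))
      without-∈ a (y ∷ ys) (there m) u@(_ ∷ u′) with y ≟ a
      ... | no _ = cong suc (without-∈ a ys m u′)
      ... | yes refl = contradiction m (Unique[x∷xs]⇒x∉xs u)

      without-fixedCount : ∀ a ys → ¬ h a ≡ a → fixedCount (without a ys) ≡ fixedCount ys
      without-fixedCount a [] _ = refl
      without-fixedCount a (y ∷ ys) ha≢a with y ≟ a
      without-fixedCount a (y ∷ ys) ha≢a | no _ with Fixed? y
      ... | yes _ = cong suc (without-fixedCount a ys ha≢a)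
      ... | no _ = without-fixedCount a ys ha≢a
      without-fixedCount a (y ∷ ys) ha≢a | yes refl with Fixed? y
      ... | yes hy≡y = contradiction hy≡y ha≢a
      ... | no _ = without-fixedCount a ys ha≢a

      Closed Involutive : List A → Set
      Closed xs = ∀ {x} → x ∈ xs → h x ∈ xs
      Involutive xs = ∀ {x} → x ∈ xs → h (h x) ≡ x

      drop-fixed-closed : ∀ x ys → Unique (x ∷ ys) → h x ≡ x → Closed (x ∷ ys) → Involutive (x ∷ ys) → Closed ys
      drop-fixed-closed x ys u hx≡x closed invol {y} m with closed (there m)
      ... | there m′ = m′
      ... | here hy≡x = contradiction (subst (_∈ ys) y≡x m) (Unique[x∷xs]⇒x∉xs u)
        where
        y≡x : y ≡ x
        y≡x = trans (sym (invol (there m))) (trans (cong h hy≡x) hx≡x)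

      drop-orbit-closed : ∀ x ys → x ∉ ys → Closed (x ∷ ys) → Involutive (x ∷ ys) → Closed (without (h x) ys)
      drop-orbit-closed x ys x∉ys closed invol {y} m with ∈-filter⁻ (≢? (h x)) {xs = ys} m
      ... | (y∈ys , y≢hx) with closed (there y∈ys)
      ...   | here hy≡x = contradiction (trans (sym (invol (there y∈ys))) (cong h hy≡x)) y≢hx
      ...   | there hy∈ys = ∈-filter⁺ (≢? (h x)) hy∈ys (λ hy≡hx → contradiction
                (subst (_∈ ys) (trans (sym (invol (there y∈ys))) (trans (cong h hy≡hx) (invol (here refl)))) y∈ys) x∉ys)

      suc-suc-+2* : ∀ a c → suc (suc (a + 2 * c)) ≡ a + 2 * suc c
      suc-suc-+2* = solve-∀

      parity : ∀ n xs → length xs ≤ n → Unique xs → Closed xs → Involutive xs →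
               ∃ λ c → length xs ≡ fixedCount xs + 2 * c
      parity n [] _ _ _ _ = 0 , refl
      parity (suc n) (x ∷ ys) (s≤s len) u@(_ ∷ uys) closed invol with Fixed? x
      ... | yes hx≡x =
        let (c , eq) = parity n ys len uys (drop-fixed-closed x ys u hx≡x closed invol) (λ m → invol (there m))
        in c , cong suc eq
      ... | no hx≢x = suc c , count
        where
        x∉ys : x ∉ ys
        x∉ys = Unique[x∷xs]⇒x∉xs u

        hx∈ys : h x ∈ ys
        hx∈ys with closed (here refl)
        ... | here hx≡x = contradiction hx≡x hx≢x
        ... | there m = m

        zs : List A
        zs = without (h x) ys

        |zs| : suc (length zs) ≡ length ys
        |zs| = without-∈ (h x) ys hx∈ys uys

        IH : ∃ λ c → length zs ≡ fixedCount zs + 2 * c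
        IH = parity n zs (≤-trans (n≤1+n _) (subst (_≤ n) (sym |zs|) len)) (filter⁺ (≢? (h x)) uys)
                    (drop-orbit-closed x ys x∉ys closed invol)
                    (λ m → invol (there (proj₁ (∈-filter⁻ (≢? (h x)) {xs = ys} m))))

        c : ℕ
        c = proj₁ IH

        hhx≢hx : ¬ h (h x) ≡ h x
        hhx≢hx e = hx≢x (trans (sym e) (invol (here refl)))

        count : suc (length ys) ≡ fixedCount ys + 2 * suc c
        count = begin
          suc (length ys)                         ≡⟨ cong suc (sym |zs|) ⟩
          suc (suc (length zs))                   ≡⟨ cong (λ t → suc (suc t)) (proj₂ IH) ⟩
          suc (suc (fixedCount zs + 2 * c))       ≡⟨ cong (λ t → suc (suc (t + 2 * c))) (without-fixedCount (h x) ys hhx≢hx) ⟩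
          suc (suc (fixedCount ys + 2 * c))       ≡⟨ suc-suc-+2* (fixedCount ys) c ⟩
          fixedCount ys + 2 * suc c               ∎
          where open ≡-Reasoning

    involution-parity : ∀ xs → Unique xs →
      (∀ {x} → x ∈ xs → h x ∈ xs) → (∀ {x} → x ∈ xs → h (h x) ≡ x) →
      ∃ λ c → length xs ≡ fixedCount xs + 2 * c
    involution-parity xs = parity (length xs) xs ≤-refl

module Zagier where

  open import Data.Nat
  open import Data.Nat.Properties
  open import Data.Nat.Divisibility using (divides)
  open import Data.Nat.Primality using (Prime; prime⇒irreducible; prime⇒nonTrivial)
  open import Data.List using ([]; _∷_)
  open import Data.Product using (_,_; _×_; proj₁; proj₂)
  open import Data.Sum using (inj₁; inj₂)
  open import Relation.Binary.PropositionalEquality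
  open import Relation.Nullary using (¬_; yes; no)
  open import Relation.Nullary.Negation using (contradiction)
  open import Data.Empty using (⊥-elim)
  import Data.Nat.Tactic.RingSolver as Solver
  open PrimeFacts using (prime>1; prime≢square)

  Triple : Set
  Triple = ℕ × ℕ × ℕ

  Windmill : ℕ → Triple → Set
  Windmill n (x , y , z) = 0 < x × 0 < y × 0 < z × x * x + 4 * (y * z) ≡ n

  zagier : Triple → Triple
  zagier (x , y , z) with x + z <? y
  ... | yes _ = (x + 2 * z , z , y ∸ (x + z))
  ... | no _ with x <? 2 * y
  ...   | yes _ = (2 * y ∸ x , y , (x + z) ∸ y)
  ...   | no _ = (x ∸ 2 * y , (x + z) ∸ y , y)

  zagier-small : ∀ x y z → x + z < y → zagier (x , y , z) ≡ (x + 2 * z , z , y ∸ (x + z))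
  zagier-small x y z lt with x + z <? y
  ... | yes _ = refl
  ... | no ≮ = contradiction lt ≮

  zagier-middle : ∀ x y z → ¬ x + z < y → x < 2 * y → zagier (x , y , z) ≡ (2 * y ∸ x , y , (x + z) ∸ y)
  zagier-middle x y z ≮₁ lt with x + z <? y
  ... | yes l = contradiction l ≮₁
  ... | no _ with x <? 2 * y
  ...   | yes _ = refl
  ...   | no ≮₂ = contradiction lt ≮₂

  zagier-large : ∀ x y z → ¬ x + z < y → ¬ x < 2 * y → zagier (x , y , z) ≡ (x ∸ 2 * y , (x + z) ∸ y , y)
  zagier-large x y z ≮₁ ≮₂ with x + z <? y
  ... | yes l = contradiction l ≮₁
  ... | no _ with x <? 2 * y
  ...   | yes l = contradiction l ≮₂
  ...   | no _ = refl

  -- The middle case preserves x² + 4yz: with x + a = 2y and y + c = x + z,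
  -- a² + 4yc = x² + 4yz (add 2(x + a)y to both sides and expand).
  middle-invariant : ∀ x y z a c → x + a ≡ 2 * y → y + c ≡ x + z → a * a + 4 * (y * c) ≡ x * x + 4 * (y * z)
  middle-invariant x y z a c ha hc = +-cancelʳ-≡ (2 * ((x + a) * y)) _ _ (trans lhs (sym rhs))
    where
    open ≡-Reasoning
    lhs : a * a + 4 * (y * c) + 2 * ((x + a) * y) ≡ a * a + 2 * ((x + a) * x) + 2 * ((x + a) * z)
    lhs = begin
      a * a + 4 * (y * c) + 2 * ((x + a) * y)          ≡⟨ Solver.solve (a ∷ y ∷ c ∷ x ∷ []) ⟩
      a * a + 2 * ((2 * y) * c) + 2 * ((x + a) * y)    ≡⟨ cong (λ t → a * a + 2 * (t * c) + 2 * ((x + a) * y)) (sym ha) ⟩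
      a * a + 2 * ((x + a) * c) + 2 * ((x + a) * y)    ≡⟨ Solver.solve (a ∷ x ∷ c ∷ y ∷ []) ⟩
      a * a + 2 * ((x + a) * (y + c))                  ≡⟨ cong (λ t → a * a + 2 * ((x + a) * t)) hc ⟩
      a * a + 2 * ((x + a) * (x + z))                  ≡⟨ Solver.solve (a ∷ x ∷ z ∷ []) ⟩
      a * a + 2 * ((x + a) * x) + 2 * ((x + a) * z)    ∎
    rhs : x * x + 4 * (y * z) + 2 * ((x + a) * y) ≡ a * a + 2 * ((x + a) * x) + 2 * ((x + a) * z)
    rhs = begin
      x * x + 4 * (y * z) + 2 * ((x + a) * y)          ≡⟨ Solver.solve (x ∷ y ∷ z ∷ a ∷ []) ⟩
      x * x + 2 * ((2 * y) * z) + (x + a) * (2 * y)    ≡⟨ cong₂ (λ t u → x * x + 2 * (t * z) + (x + a) * u) (sym ha) (sym ha) ⟩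
      x * x + 2 * ((x + a) * z) + (x + a) * (x + a)    ≡⟨ Solver.solve (x ∷ z ∷ a ∷ []) ⟩
      a * a + 2 * ((x + a) * x) + 2 * ((x + a) * z)    ∎

  module _ (p k : ℕ) (pr : Prime p) (p≡4k+1 : p ≡ 4 * k + 1) where

    -- The boundary cases y = x + z and x = 2y never occur for a windmill of p:
    -- they would make p a square, resp. even.
    windmill-y≢x+z : ∀ x y z → Windmill p (x , y , z) → x + z ≢ y
    windmill-y≢x+z x y z (_ , _ , _ , e) refl = prime≢square pr (x + 2 * z) (trans (sym e) (square x z))
      where
      square : ∀ x z → x * x + 4 * ((x + z) * z) ≡ (x + 2 * z) * (x + 2 * z)
      square = Solver.solve-∀

    windmill-x≢2y : ∀ x y z → Windmill p (x , y , z) → x ≢ 2 * y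
    windmill-x≢2y x y z (_ , _ , _ , e) refl = even≢odd (2 * (y * y + y * z)) (2 * k)
      (trans (even y z) (trans e (trans p≡4k+1 (odd k))))
      where
      even : ∀ y z → 2 * (2 * (y * y + y * z)) ≡ 2 * y * (2 * y) + 4 * (y * z)
      even = Solver.solve-∀
      odd : ∀ k → 4 * k + 1 ≡ suc (2 * (2 * k))
      odd = Solver.solve-∀

    record Involutive (t : Triple) : Set where
      field
        maps-to : Windmill p (zagier t)
        involutive : zagier (zagier t) ≡ t
        unique-fixed : zagier t ≡ t → t ≡ (1 , 1 , k)

    involutive-via : ∀ {t t′} → zagier t ≡ t′ → Windmill p t′ → zagier t′ ≡ t →
                     (t′ ≡ t → t ≡ (1 , 1 , k)) → Involutive t
    involutive-via refl w back fixed = record { maps-to = w ; involutive = back ; unique-fixed = fixed }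

    small-case : ∀ x y z → Windmill p (x , y , z) → x + z < y → Involutive (x , y , z)
    small-case x y z (x>0 , y>0 , z>0 , e) lt = involutive-via (zagier-small x y z lt)
      (≤-trans x>0 (m≤m+n x (2 * z)) , z>0 , m<n⇒0<n∸m lt ,
       trans (invariant x z w) (trans (cong (λ t → x * x + 4 * (t * z)) hy) e))
      back
      (λ eq → contradiction (+-cancelˡ-≡ x (2 * z) 0 (trans (cong proj₁ eq) (sym (+-identityʳ x))))
                            (λ 2z≡0 → <⇒≢ z>0 (sym (m*n≡0⇒m≡0 z 2 (trans (*-comm z 2) 2z≡0)))))
      where
      w : ℕ
      w = y ∸ (x + z)
      hy : x + z + w ≡ y
      hy = m+[n∸m]≡n (<⇒≤ lt)
      invariant : ∀ x z w → (x + 2 * z) * (x + 2 * z) + 4 * (z * w) ≡ x * x + 4 * ((x + z + w) * z)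
      invariant = Solver.solve-∀
      regroup : ∀ x z w → x + 2 * z + w ≡ x + z + w + z
      regroup = Solver.solve-∀
      back : zagier (x + 2 * z , z , w) ≡ (x , y , z)
      back = trans (zagier-large (x + 2 * z) z w
                     (λ l → <⇒≱ l (≤-trans (m≤n+m z (x + z + w)) (≤-reflexive (sym (regroup x z w)))))
                     (λ l → <⇒≱ l (m≤n+m (2 * z) x)))
        (cong₂ (λ a b → (a , b , z)) (m+n∸n≡m x (2 * z))
           (trans (cong (_∸ z) (regroup x z w)) (trans (m+n∸n≡m (x + z + w) z) hy)))

    -- In the large case x - 2y > 0, since x = 2y is excluded; write x = 2y + (1 + v).
    large-case : ∀ x y z → Windmill p (x , y , z) → ¬ x + z < y → ¬ x < 2 * y → Involutive (x , y , z)
    large-case x y z s@(_ , y>0 , z>0 , e) ≮₁ ≮₂ with x ∸ 2 * y | m+[n∸m]≡n (≮⇒≥ ≮₂)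
    ... | zero | refl = ⊥-elim (windmill-x≢2y (2 * y + 0) y z s (+-identityʳ _))
    ... | suc v | refl = involutive-via image
      (s≤s z≤n , s≤s z≤n , y>0 , trans (invariant (suc v) y z) e)
      back
      (λ eq → contradiction (cong (λ t → proj₁ (proj₂ t)) eq)
                            (λ e₂ → <⇒≢ (≤-trans (s≤s (m≤n+m y v)) (m≤m+n (suc v + y) z)) (sym e₂)))
      where
      regroup : ∀ v y z → 2 * y + v + z ≡ v + y + z + y
      regroup = Solver.solve-∀
      invariant : ∀ v y z → v * v + 4 * ((v + y + z) * y) ≡ (2 * y + v) * (2 * y + v) + 4 * (y * z)
      invariant = Solver.solve-∀
      image : zagier (2 * y + suc v , y , z) ≡ (suc v , suc v + y + z , y)
      image = trans (zagier-large (2 * y + suc v) y z ≮₁ ≮₂)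
        (cong₂ (λ a b → (a , b , y)) (m+n∸m≡n (2 * y) (suc v))
           (trans (cong (_∸ y) (regroup (suc v) y z)) (m+n∸n≡m (suc v + y + z) y)))
      back : zagier (suc v , suc v + y + z , y) ≡ (2 * y + suc v , y , z)
      back = trans (zagier-small (suc v) (suc v + y + z) y (m<m+n (suc v + y) z>0))
        (cong₂ (λ a b → (a , y , b)) (Solver.solve (v ∷ y ∷ [])) (m+n∸m≡n (suc v + y) z))

    factor : ∀ x z → x * x + 4 * (x * z) ≡ (x + 4 * z) * x
    factor = Solver.solve-∀

    -- A windmill with x = y is (1, 1, k): then x ∣ x² + 4xz = p, so x = 1.
    diagonal-windmill : ∀ x y z → Windmill p (x , y , z) → x ≡ y → (x , y , z) ≡ (1 , 1 , k)
    diagonal-windmill x y z (_ , _ , _ , e) refl with prime⇒irreducible pr (divides (x + 4 * z) (trans (sym e) (factor x z)))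
    ... | inj₁ refl = cong (λ t → (1 , 1 , t)) (*-cancelˡ-≡ z k 4 (+-cancelʳ-≡ 1 _ _ (trans (sym (at1 z)) (trans e p≡4k+1))))
      where
      at1 : ∀ z → 1 * 1 + 4 * (1 * z) ≡ 4 * z + 1
      at1 = Solver.solve-∀
    ... | inj₂ refl = ⊥-elim (<⇒≢ (≤-trans (prime>1 pr) (m≤m+n x (4 * z))) (sym
            (*-cancelʳ-≡ (x + 4 * z) 1 x {{nonTrivial⇒nonZero x {{prime⇒nonTrivial pr}}}}
              (trans (sym (factor x z)) (trans e (sym (*-identityˡ x)))))))

    middle-case : ∀ x y z → Windmill p (x , y , z) → ¬ x + z < y → x < 2 * y → Involutive (x , y , z)
    middle-case x y z s@(x>0 , y>0 , z>0 , e) ≮₁ lt = involutive-via (zagier-middle x y z ≮₁ lt)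
      (m<n⇒0<n∸m lt , y>0 , m<n⇒0<n∸m y<x+z , trans (middle-invariant x y z a c ha hc) e)
      back
      (λ eq → diagonal-windmill x y z s (*-cancelˡ-≡ x y 2 (trans (sym (double x))
                (trans (cong (x +_) (sym (cong proj₁ eq))) ha))))
      where
      y<x+z : y < x + z
      y<x+z = ≤∧≢⇒< (≮⇒≥ ≮₁) (λ q → windmill-y≢x+z x y z s (sym q))
      a c : ℕ
      a = 2 * y ∸ x
      c = (x + z) ∸ y
      ha : x + a ≡ 2 * y
      ha = m+[n∸m]≡n (<⇒≤ lt)
      hc : y + c ≡ x + z
      hc = m+[n∸m]≡n (<⇒≤ y<x+z)
      double : ∀ x → x + x ≡ 2 * x
      double = Solver.solve-∀
      a+c≡y+z : a + c ≡ y + z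
      a+c≡y+z = +-cancelˡ-≡ (x + y) _ _ (trans (shuffle x y a c) (trans (cong₂ _+_ ha hc) (shuffle′ x y z)))
        where
        shuffle : ∀ x y a c → x + y + (a + c) ≡ (x + a) + (y + c)
        shuffle = Solver.solve-∀
        shuffle′ : ∀ x y z → 2 * y + (x + z) ≡ x + y + (y + z)
        shuffle′ = Solver.solve-∀
      back : zagier (a , y , c) ≡ (x , y , z)
      back = trans (zagier-middle a y c (λ l → <⇒≱ l (subst (y ≤_) (sym a+c≡y+z) (m≤m+n y z)))
                                        (subst (a <_) ha (+-monoˡ-≤ a x>0)))
        (cong₂ (λ u w → (u , y , w)) (trans (cong (_∸ a) (sym ha)) (m+n∸n≡m x a))
                                     (trans (cong (_∸ y) a+c≡y+z) (m+n∸m≡n y z)))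

    zagier-involutive : ∀ t → Windmill p t → Involutive t
    zagier-involutive (x , y , z) s with x + z <? y | x <? 2 * y
    ... | yes lt | _ = small-case x y z s lt
    ... | no ≮₁ | yes lt = middle-case x y z s ≮₁ lt
    ... | no ≮₁ | no ≮₂ = large-case x y z s ≮₁ ≮₂

module TwoSquares where

  open import Data.Nat
  open import Data.Nat.Properties
  open import Data.Nat.DivMod using (_%_; _/_; m≡m%n+[m/n]*n)
  open import Data.Nat.Primality using (Prime)
  open import Data.List using (List; []; _∷_; length; filter; upTo; cartesianProduct)
  open import Data.List.Membership.Propositional using (_∈_)
  open import Data.List.Membership.Propositional.Properties using (∈-filter⁺; ∈-filter⁻; ∈-upTo⁺; ∈-cartesianProduct⁺)
  open import Data.List.Relation.Unary.Any using (here; there)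
  open import Data.List.Relation.Unary.AllPairs using (_∷_)
  import Data.List.Relation.Unary.All as All
  open import Data.List.Relation.Unary.Unique.Propositional using (Unique)
  open import Data.List.Relation.Unary.Unique.Propositional.Properties using (filter⁺; upTo⁺; cartesianProduct⁺)
  open import Data.Product using (∃; ∃₂; _,_; _×_; proj₁; proj₂)
  open import Data.Product.Properties using (≡-dec)
  open import Relation.Binary.PropositionalEquality
  open import Relation.Nullary using (Dec; _×-dec_)
  open import Data.Empty using (⊥-elim)
  import Data.Nat.Tactic.RingSolver as Solver
  open PrimeFacts using (prime>1)
  open InvolutionParity using (fixedCount; Fixed?; involution-parity)
  open Zagier

  _≟ᵗ_ : (s t : Triple) → Dec (s ≡ t)
  _≟ᵗ_ = ≡-dec _≟_ (≡-dec _≟_ _≟_)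

  windmill? : ∀ n t → Dec (Windmill n t)
  windmill? n (x , y , z) = (0 <? x) ×-dec ((0 <? y) ×-dec ((0 <? z) ×-dec (x * x + 4 * (y * z) ≟ n)))

  swap : Triple → Triple
  swap (x , y , z) = (x , z , y)

  length-≡1 : ∀ {a : Triple} xs → Unique xs → (∀ {t} → t ∈ xs → t ≡ a) → a ∈ xs → length xs ≡ 1
  length-≡1 (_ ∷ []) _ _ _ = refl
  length-≡1 (_ ∷ _ ∷ _) ((y≢z All.∷ _) ∷ _) all≡a _ =
    ⊥-elim (y≢z (trans (all≡a (here refl)) (sym (all≡a (there (here refl))))))

  -- Zagier's proof: the windmills of p = 4k + 1 form a finite set on which both
  -- `zagier` and `swap` are involutions. `zagier` has exactly one fixed point, so
  -- the set has odd size and `swap` has a fixed point (x, y, y), i.e. p = x² + (2y)².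
  module _ (p k : ℕ) (pr : Prime p) (p≡4k+1 : p ≡ 4 * k + 1) where

    box : List Triple
    box = cartesianProduct (upTo (suc p)) (cartesianProduct (upTo (suc p)) (upTo (suc p)))

    windmills : List Triple
    windmills = filter (windmill? p) box

    windmills-unique : Unique windmills
    windmills-unique = filter⁺ (windmill? p)
      (cartesianProduct⁺ (upTo⁺ (suc p)) (cartesianProduct⁺ (upTo⁺ (suc p)) (upTo⁺ (suc p))))

    windmill-bounded : ∀ {x y z} → Windmill p (x , y , z) → x ≤ p × y ≤ p × z ≤ p
    windmill-bounded {suc x} {suc y} {suc z} (_ , _ , _ , e) =
      ≤-trans (m≤m+n (suc x) _) (≤-trans (m≤m+n (suc x * suc x) _) (≤-reflexive e)) ,
      ≤-trans (m≤m*n (suc y) (suc z)) yz≤p ,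
      ≤-trans (m≤n*m (suc z) (suc y)) yz≤p
      where
      yz≤p : suc y * suc z ≤ p
      yz≤p = ≤-trans (m≤m+n (suc y * suc z) _) (≤-trans (m≤n+m _ (suc x * suc x)) (≤-reflexive e))

    ∈-windmills⁺ : ∀ {t} → Windmill p t → t ∈ windmills
    ∈-windmills⁺ {x , y , z} w with windmill-bounded w
    ... | x≤p , y≤p , z≤p = ∈-filter⁺ (windmill? p) (∈-cartesianProduct⁺ (∈-upTo⁺ (s≤s x≤p))
            (∈-cartesianProduct⁺ (∈-upTo⁺ (s≤s y≤p)) (∈-upTo⁺ (s≤s z≤p)))) w

    ∈-windmills⁻ : ∀ {t} → t ∈ windmills → Windmill p t
    ∈-windmills⁻ m = proj₂ (∈-filter⁻ (windmill? p) {xs = box} m)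

    zagier-parity : ∃ λ c → length windmills ≡ fixedCount _≟ᵗ_ zagier windmills + 2 * c
    zagier-parity = involution-parity _≟ᵗ_ zagier windmills windmills-unique
      (λ m → ∈-windmills⁺ (Involutive.maps-to (zagier-involutive p k pr p≡4k+1 _ (∈-windmills⁻ m))))
      (λ m → Involutive.involutive (zagier-involutive p k pr p≡4k+1 _ (∈-windmills⁻ m)))

    swap-parity : ∃ λ c → length windmills ≡ fixedCount _≟ᵗ_ swap windmills + 2 * c
    swap-parity = involution-parity _≟ᵗ_ swap windmills windmills-unique
      (λ {t} m → ∈-windmills⁺ (swap-windmill t (∈-windmills⁻ m)))
      (λ _ → refl)
      where
      swap-windmill : ∀ t → Windmill p t → Windmill p (swap t)
      swap-windmill (x , y , z) (x>0 , y>0 , z>0 , e) =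
        x>0 , z>0 , y>0 , trans (cong (λ u → x * x + 4 * u) (*-comm z y)) e

    zagier-one-fixed-point : fixedCount _≟ᵗ_ zagier windmills ≡ 1
    zagier-one-fixed-point = length-≡1 _ (filter⁺ (Fixed? _≟ᵗ_ zagier) windmills-unique)
      (λ m → let (m₁ , fixed) = ∈-filter⁻ (Fixed? _≟ᵗ_ zagier) {xs = windmills} m
             in Involutive.unique-fixed (zagier-involutive p k pr p≡4k+1 _ (∈-windmills⁻ m₁)) fixed)
      (∈-filter⁺ (Fixed? _≟ᵗ_ zagier) (∈-windmills⁺ w₀) fixed₀)
      where
      k>0 : 0 < k
      k>0 = n≢0⇒n>0 (λ k≡0 → <⇒≢ (prime>1 pr) (sym (trans p≡4k+1 (cong (λ t → 4 * t + 1) k≡0))))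
      at1 : ∀ k → 1 * 1 + 4 * (1 * k) ≡ 4 * k + 1
      at1 = Solver.solve-∀
      w₀ : Windmill p (1 , 1 , k)
      w₀ = s≤s z≤n , s≤s z≤n , k>0 , trans (at1 k) (sym p≡4k+1)
      fixed₀ : zagier (1 , 1 , k) ≡ (1 , 1 , k)
      fixed₀ = zagier-middle 1 1 k (λ l → <⇒≱ l (m≤m+n 1 k)) (s≤s (s≤s z≤n))

    two-squares-4k+1 : ∃₂ λ a b → a * a + b * b ≡ p
    two-squares-4k+1 with zagier-parity | swap-parity
    ... | c₁ , e₁ | c₂ , e₂ with filter (Fixed? _≟ᵗ_ swap) windmills in eq
    ... | [] = ⊥-elim (even≢odd c₂ c₁ (trans (sym e₂) (trans e₁ (cong (_+ 2 * c₁) zagier-one-fixed-point))))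
    ... | (x , y , z) ∷ _ with ∈-filter⁻ (Fixed? _≟ᵗ_ swap) {xs = windmills} (subst ((x , y , z) ∈_) (sym eq) (here refl))
    ...   | m , fixed with ∈-windmills⁻ m | cong (λ t → proj₁ (proj₂ t)) fixed
    ...     | (_ , _ , _ , e) | refl = x , 2 * y , trans (regroup x y) e
      where
      regroup : ∀ x y → x * x + 2 * y * (2 * y) ≡ x * x + 4 * (y * y)
      regroup = Solver.solve-∀

  fermat : ∀ p → Prime p → p % 4 ≡ 1 → ∃₂ λ a b → a * a + b * b ≡ p
  fermat p pr p%4≡1 = two-squares-4k+1 p (p / 4) pr
    (trans (m≡m%n+[m/n]*n p 4) (trans (cong (_+ (p / 4) * 4) p%4≡1) (regroup (p / 4))))
    where
    regroup : ∀ k → 1 + k * 4 ≡ 4 * k + 1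
    regroup = Solver.solve-∀

module Gaussian where

  open import Data.Nat as ℕ using (ℕ; zero; suc)
  import Data.Nat.Properties as ℕP
  open import Data.Integer as ℤ using (ℤ; +_; -_; _+_; _-_; _*_; ∣_∣; -[1+_]; NonZero; ≢-nonZero)
  import Data.Integer.Properties as ℤP
  open import Data.Product using (∃; _,_; _×_; proj₁; proj₂)
  open import Data.Sum using (_⊎_; inj₁; inj₂; [_,_]′)
  open import Function using (id)
  open import Relation.Binary.PropositionalEquality
  open import Relation.Nullary.Negation using (contradiction)
  open import Data.Integer.Tactic.RingSolver using (solve-∀)

  ℤ[i] : Set
  ℤ[i] = ℤ × ℤ

  infixl 7 _·_

  -- Multiplication is kept abstract (unfolded only through ·-def), which keeps
  -- the normal forms of the terms built from it small.
  abstract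
    _·_ : ℤ[i] → ℤ[i] → ℤ[i]
    (a , b) · (c , d) = (a * c - b * d , a * d + b * c)

    ·-def : ∀ a b c d → (a , b) · (c , d) ≡ (a * c - b * d , a * d + b * c)
    ·-def a b c d = refl

  N : ℤ[i] → ℤ
  N (a , b) = a * a + b * b

  1ᵍ : ℤ[i]
  1ᵍ = (+ 1 , + 0)

  conj : ℤ[i] → ℤ[i]
  conj (a , b) = (a , - b)

  infixr 8 _^_
  _^_ : ℤ[i] → ℕ → ℤ[i]
  z ^ zero = 1ᵍ
  z ^ suc n = z · z ^ n

  abstract
    ·-assoc : ∀ x y z → (x · y) · z ≡ x · (y · z)
    ·-assoc (a , b) (c , d) (e , f) = cong₂ _,_ (re a b c d e f) (im a b c d e f)
      where
      re : ∀ a b c d e f → (a * c - b * d) * e - (a * d + b * c) * f ≡ a * (c * e - d * f) - b * (c * f + d * e)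
      re = solve-∀
      im : ∀ a b c d e f → (a * c - b * d) * f + (a * d + b * c) * e ≡ a * (c * f + d * e) + b * (c * e - d * f)
      im = solve-∀

    ·-comm : ∀ x y → x · y ≡ y · x
    ·-comm (a , b) (c , d) = cong₂ _,_ (re a b c d) (im a b c d)
      where
      re : ∀ a b c d → a * c - b * d ≡ c * a - d * b
      re = solve-∀
      im : ∀ a b c d → a * d + b * c ≡ c * b + d * a
      im = solve-∀

    ·-identityˡ : ∀ x → 1ᵍ · x ≡ x
    ·-identityˡ (a , b) = cong₂ _,_ (re a b) (im a b)
      where
      re : ∀ a b → + 1 * a - + 0 * b ≡ a
      re = solve-∀
      im : ∀ a b → + 1 * b + + 0 * a ≡ b
      im = solve-∀

    conj-·-self : ∀ z → conj z · z ≡ (N z , + 0)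
    conj-·-self (a , b) = cong₂ _,_ (re a b) (im a b)
      where
      re : ∀ a b → a * a - - b * b ≡ a * a + b * b
      re = solve-∀
      im : ∀ a b → a * b + - b * a ≡ + 0
      im = solve-∀

    N-· : ∀ x y → N (x · y) ≡ N x * N y
    N-· (a , b) (c , d) = brahmagupta a b c d
      where
      brahmagupta : ∀ a b c d → (a * c - b * d) * (a * c - b * d) + (a * d + b * c) * (a * d + b * c)
                                ≡ (a * a + b * b) * (c * c + d * d)
      brahmagupta = solve-∀

  ·-exchange : ∀ x u y → x · (u · y) ≡ u · (x · y)
  ·-exchange x u y = trans (sym (·-assoc x u y)) (trans (cong (_· y) (·-comm x u)) (·-assoc u x y))

  N-conj : ∀ z → N (conj z) ≡ N z
  N-conj (a , b) = negate² a b
    where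
    negate² : ∀ a b → a * a + - b * - b ≡ a * a + b * b
    negate² = solve-∀

  N-^ : ∀ z n → N (z ^ n) ≡ N z ℤ.^ n
  N-^ z zero = refl
  N-^ z (suc n) = trans (N-· z (z ^ n)) (cong (N z *_) (N-^ z n))

  ^-+ : ∀ z m n → z ^ (m ℕ.+ n) ≡ z ^ m · z ^ n
  ^-+ z zero n = sym (·-identityˡ _)
  ^-+ z (suc m) n = trans (cong (z ·_) (^-+ z m n)) (sym (·-assoc z _ _))

  square≡ : ∀ i → i * i ≡ + (∣ i ∣ ℕ.* ∣ i ∣)
  square≡ (+ n) = sym (ℤP.pos-* n n)
  square≡ -[1+ n ] = refl

  square≡0 : ∀ i → i * i ≡ + 0 → i ≡ + 0
  square≡0 i e = [ id , id ]′ (ℤP.i*j≡0⇒i≡0∨j≡0 i e)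

  N≡0 : ∀ z → N z ≡ + 0 → z ≡ (+ 0 , + 0)
  N≡0 (a , b) e = cong₂ _,_
    (square≡0 a (trans (square≡ a) (cong +_ (ℕP.m+n≡0⇒m≡0 _ sum≡0))))
    (square≡0 b (trans (square≡ b) (cong +_ (ℕP.m+n≡0⇒n≡0 (∣ a ∣ ℕ.* ∣ a ∣) sum≡0))))
    where
    sum≡0 : ∣ a ∣ ℕ.* ∣ a ∣ ℕ.+ ∣ b ∣ ℕ.* ∣ b ∣ ≡ 0
    sum≡0 = ℤP.+-injective (trans (ℤP.pos-+ (∣ a ∣ ℕ.* ∣ a ∣) (∣ b ∣ ℕ.* ∣ b ∣))
              (trans (sym (cong₂ _+_ (square≡ a) (square≡ b))) e))

  -- ℤ[i] has no zero divisors: z (A - B) = 0 with z ≠ 0 forces A = B.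
  ·-cancelˡ : ∀ z A B → N z ≢ + 0 → z · A ≡ z · B → A ≡ B
  ·-cancelˡ z@(x , y) (a₁ , a₂) (b₁ , b₂) Nz≢0 eq =
    cong₂ _,_ (ℤP.i-j≡0⇒i≡j a₁ b₁ (cong proj₁ D≡0)) (ℤP.i-j≡0⇒i≡j a₂ b₂ (cong proj₂ D≡0))
    where
    D : ℤ[i]
    D = (a₁ - b₁ , a₂ - b₂)
    eq′ : (x * a₁ - y * a₂ , x * a₂ + y * a₁) ≡ (x * b₁ - y * b₂ , x * b₂ + y * b₁)
    eq′ = trans (sym (·-def x y a₁ a₂)) (trans eq (·-def x y b₁ b₂))
    re : ∀ x y a₁ a₂ b₁ b₂ → x * (a₁ - b₁) - y * (a₂ - b₂) ≡ (x * a₁ - y * a₂) - (x * b₁ - y * b₂)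
    re = solve-∀
    im : ∀ x y a₁ a₂ b₁ b₂ → x * (a₂ - b₂) + y * (a₁ - b₁) ≡ (x * a₂ + y * a₁) - (x * b₂ + y * b₁)
    im = solve-∀
    zD≡0 : z · D ≡ (+ 0 , + 0)
    zD≡0 = trans (·-def x y (a₁ - b₁) (a₂ - b₂)) (cong₂ _,_
      (trans (re x y a₁ a₂ b₁ b₂) (ℤP.i≡j⇒i-j≡0 (cong proj₁ eq′)))
      (trans (im x y a₁ a₂ b₁ b₂) (ℤP.i≡j⇒i-j≡0 (cong proj₂ eq′))))
    D≡0 : D ≡ (+ 0 , + 0)
    D≡0 with ℤP.i*j≡0⇒i≡0∨j≡0 (N z) (trans (sym (N-· z D)) (cong N zD≡0))
    ... | inj₁ Nz≡0 = contradiction Nz≡0 Nz≢0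
    ... | inj₂ ND≡0 = N≡0 D ND≡0

  Assoc : ℤ[i] → ℤ[i] → Set
  Assoc α β = ∃ λ u → N u ≡ + 1 × α ≡ u · β

  assoc-sym : ∀ α β → Assoc α β → Assoc β α
  assoc-sym α β (u , Nu≡1 , α≡uβ) = conj u , trans (N-conj u) Nu≡1 , sym (begin
    conj u · α           ≡⟨ cong (conj u ·_) α≡uβ ⟩
    conj u · (u · β)     ≡⟨ sym (·-assoc (conj u) u β) ⟩
    conj u · u · β       ≡⟨ cong (_· β) (trans (conj-·-self u) (cong (_, + 0) Nu≡1)) ⟩
    1ᵍ · β               ≡⟨ ·-identityˡ β ⟩
    β                    ∎)
    where open ≡-Reasoning

  assoc-trans : ∀ α β γ → Assoc α β → Assoc β γ → Assoc α γ
  assoc-trans α β γ (u , Nu≡1 , α≡uβ) (v , Nv≡1 , β≡vγ) =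
    u · v , trans (N-· u v) (cong₂ _*_ Nu≡1 Nv≡1) ,
    trans α≡uβ (trans (cong (u ·_) β≡vγ) (sym (·-assoc u v γ)))

  assoc-cancel : ∀ c α β → N c ≢ + 0 → Assoc (c · α) (c · β) → Assoc α β
  assoc-cancel c α β Nc≢0 (u , Nu≡1 , e) = u , Nu≡1 , ·-cancelˡ c α (u · β) Nc≢0 (trans e (·-exchange u c β))

  rotate : ℤ[i] → ℤ[i]
  rotate (a , b) = (- b , a)

  rotate-assoc : ∀ γ → Assoc (rotate γ) γ
  rotate-assoc (c , d) = (+ 0 , + 1) , refl , sym (trans (·-def (+ 0) (+ 1) c d) (cong₂ _,_ (re c d) (im c d)))
    where
    re : ∀ c d → + 0 * c - + 1 * d ≡ - d
    re = solve-∀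
    im : ∀ c d → + 0 * d + + 1 * c ≡ c
    im = solve-∀

  cross : ℤ[i] → ℤ[i] → ℤ
  cross (a , b) (c , d) = a * d - b * c

  square-root : ∀ x s → x * x ≡ s * s → x ≡ s ⊎ x ≡ - s
  square-root x s e with ℤP.i*j≡0⇒i≡0∨j≡0 (x - s) (trans (difference x s) (ℤP.i≡j⇒i-j≡0 e))
    where
    difference : ∀ x s → (x - s) * (x + s) ≡ x * x - s * s
    difference = solve-∀
  ... | inj₁ x-s≡0 = inj₁ (ℤP.i-j≡0⇒i≡j x s x-s≡0)
  ... | inj₂ x+s≡0 = inj₂ (ℤP.i-j≡0⇒i≡j x (- s) (trans (cong (λ t → x + t) (ℤP.neg-involutive s)) x+s≡0))

  -- Two Gaussian integers of the same nonzero norm S with cross product Y = 0 are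
  -- associates: the dot product X = ac + bd satisfies X² + Y² = S², so X = ±S,
  -- and aS = cX + dY, bS = dX - cY then give α = ±β.
  cross≡0⇒assoc : ∀ α β → N α ≡ N β → N β ≢ + 0 → cross α β ≡ + 0 → Assoc α β
  cross≡0⇒assoc (a , b) (c , d) Nα≡Nβ S≢0 Y≡0 = [ same , opposite ]′ (square-root X S X²≡S²)
    where
    S X Y : ℤ
    S = c * c + d * d
    X = a * c + b * d
    Y = a * d - b * c
    instance
      S-nonZero : NonZero S
      S-nonZero = ≢-nonZero S≢0

    lagrange : ∀ a b c d → (a * c + b * d) * (a * c + b * d) + (a * d - b * c) * (a * d - b * c)
                           ≡ (a * a + b * b) * (c * c + d * d)
    lagrange = solve-∀
    a-expand : ∀ a b c d → a * (c * c + d * d) ≡ c * (a * c + b * d) + d * (a * d - b * c)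
    a-expand = solve-∀
    b-expand : ∀ a b c d → b * (c * c + d * d) ≡ d * (a * c + b * d) + - c * (a * d - b * c)
    b-expand = solve-∀
    negate-factor : ∀ c s → c * - s ≡ - c * s
    negate-factor = solve-∀

    drop-Y : ∀ u w → u + w * Y ≡ u
    drop-Y u w = trans (cong (λ t → u + w * t) Y≡0) (trans (cong (λ t → u + t) (ℤP.*-zeroʳ w)) (ℤP.+-identityʳ u))

    X²≡S² : X * X ≡ S * S
    X²≡S² = begin
      X * X                    ≡⟨ sym (drop-Y (X * X) Y) ⟩
      X * X + Y * Y            ≡⟨ lagrange a b c d ⟩
      N (a , b) * S            ≡⟨ cong (_* S) Nα≡Nβ ⟩
      S * S                    ∎
      where open ≡-Reasoning

    aS≡cX : a * S ≡ c * X
    aS≡cX = trans (a-expand a b c d) (drop-Y (c * X) d)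
    bS≡dX : b * S ≡ d * X
    bS≡dX = trans (b-expand a b c d) (drop-Y (d * X) (- c))

    same : X ≡ S → Assoc (a , b) (c , d)
    same X≡S = 1ᵍ , refl , trans (cong₂ _,_ a≡c b≡d) (sym (·-identityˡ (c , d)))
      where
      a≡c : a ≡ c
      a≡c = ℤP.*-cancelʳ-≡ a c S (trans aS≡cX (cong (c *_) X≡S))
      b≡d : b ≡ d
      b≡d = ℤP.*-cancelʳ-≡ b d S (trans bS≡dX (cong (d *_) X≡S))

    opposite : X ≡ - S → Assoc (a , b) (c , d)
    opposite X≡-S = (- + 1 , + 0) , refl , trans (cong₂ _,_ a≡-c b≡-d) (sym (trans (·-def (- + 1) (+ 0) c d) (cong₂ _,_ (re c d) (im c d))))
      where
      a≡-c : a ≡ - c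
      a≡-c = ℤP.*-cancelʳ-≡ a (- c) S (trans aS≡cX (trans (cong (c *_) X≡-S) (negate-factor c S)))
      b≡-d : b ≡ - d
      b≡-d = ℤP.*-cancelʳ-≡ b (- d) S (trans bS≡dX (trans (cong (d *_) X≡-S) (negate-factor d S)))
      re : ∀ c d → - + 1 * c - + 0 * d ≡ - c
      re = solve-∀
      im : ∀ c d → - + 1 * d + + 0 * c ≡ - d
      im = solve-∀

module DivisibilityByπ where

  open import Data.Nat as ℕ using (ℕ; zero; suc)
  import Data.Nat.Divisibility as ℕD
  open import Data.Nat.Primality using (Prime; euclidsLemma)
  open import Data.Integer as ℤ using (ℤ; +_; -_; _+_; _-_; _*_; ∣_∣)
  import Data.Integer.Properties as ℤP
  open import Data.Integer.Divisibility.Signed using (_∣_; divides; ∣ᵤ⇒∣; ∣⇒∣ᵤ; ∣m∣n⇒∣m+n; ∣n⇒∣m*n; ∣m⇒∣m*n)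
  open import Data.Product using (_,_)
  open import Data.Sum using (_⊎_; inj₁; inj₂)
  open import Relation.Binary.PropositionalEquality
  open import Relation.Nullary using (¬_)
  open import Data.Integer.Tactic.RingSolver using (solve-∀)
  open Gaussian

  infix 4 _∣ᶻ_
  _∣ᶻ_ : ℕ → ℤ → Set
  p ∣ᶻ z = (+ p) ∣ z

  euclid : ∀ {p} → Prime p → ∀ i j → p ∣ᶻ i * j → p ∣ᶻ i ⊎ p ∣ᶻ j
  euclid {p} pr i j p∣ij with euclidsLemma ∣ i ∣ ∣ j ∣ pr (subst (p ℕD.∣_) (ℤP.abs-* i j) (∣⇒∣ᵤ p∣ij))
  ... | inj₁ p∣i = inj₁ (∣ᵤ⇒∣ p∣i)
  ... | inj₂ p∣j = inj₂ (∣ᵤ⇒∣ p∣j)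

  abstract
    ψ-π· : ∀ a b x y → b * (a * x - b * y) - a * (a * y + b * x) ≡ - y * (a * a + b * b)
    ψ-π· = solve-∀
    multiplicative : ∀ a b x y x′ y′ → b * (b * (x * x′ - y * y′) - a * (x * y′ + y * x′)) + (a * a + b * b) * (y * y′)
                     ≡ (b * x - a * y) * (b * x′ - a * y′)
    multiplicative = solve-∀
    ψ-π̄ : ∀ a b → b * a - a * (- b) ≡ + 2 * a * b
    ψ-π̄ = solve-∀
    conjugate-product : ∀ a b x y → (b * x - a * y) * (b * x + a * y) + (a * a + b * b) * (y * y) ≡ b * b * (x * x + y * y)
    conjugate-product = solve-∀
    ψ-1 : ∀ a b → b * + 1 - a * + 0 ≡ b
    ψ-1 = solve-∀

  -- For a prime p = a² + b² with p ∤ 2ab, and π = a + bi, we detect divisibility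
  -- by π through the linear form ψ(x + yi) = bx - ay (minus the imaginary part of
  -- (x + yi)π̄): p ∣ ψ z holds for every multiple of π, and this condition behaves
  -- like divisibility by a prime. This separates the products π^e π̄^(k-e).
  module Criterion (p : ℕ) (pr : Prime p) (a b : ℤ) (p≡a²+b² : a * a + b * b ≡ + p)
                   (p∤a : ¬ p ∣ᶻ a) (p∤b : ¬ p ∣ᶻ b) (p∤2 : ¬ p ∣ᶻ + 2) where

    π π̄ : ℤ[i]
    π = (a , b)
    π̄ = conj π

    ψ : ℤ[i] → ℤ
    ψ (x , y) = b * x - a * y

    π∣ : ℤ[i] → Set
    π∣ z = p ∣ᶻ ψ z

    p∣p : p ∣ᶻ + p
    p∣p = divides (+ 1) (sym (ℤP.*-identityˡ (+ p)))

    -- ψ(π w) = -y N(π)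
    π∣-multiple : ∀ w → π∣ (π · w)
    π∣-multiple (x , y) = subst π∣ (sym (·-def a b x y)) (divides (- y) (trans (ψ-π· a b x y) (cong (- y *_) p≡a²+b²)))

    -- b ψ(z w) ≡ ψ(z) ψ(w) modulo N(π) = p, so π∣ is "prime".
    π∤-· : ∀ z w → ¬ π∣ z → ¬ π∣ w → ¬ π∣ (z · w)
    π∤-· (x , y) (x′ , y′) π∤z π∤w π∣zw with euclid pr (ψ (x , y)) (ψ (x′ , y′)) p∣ψzψw
      where
      p∣ψzψw : p ∣ᶻ ψ (x , y) * ψ (x′ , y′)
      p∣ψzψw = subst (p ∣ᶻ_) (multiplicative a b x y x′ y′)
        (∣m∣n⇒∣m+n (∣n⇒∣m*n b (subst π∣ (·-def x y x′ y′) π∣zw))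
                   (subst (λ t → p ∣ᶻ t * (y * y′)) (sym p≡a²+b²) (∣m⇒∣m*n (y * y′) p∣p)))
    ... | inj₁ π∣z = π∤z π∣z
    ... | inj₂ π∣w = π∤w π∣w

    -- ψ(π̄) = 2ab
    π∤π̄ : ¬ π∣ π̄
    π∤π̄ π∣π̄ with euclid pr (+ 2 * a) b (subst (p ∣ᶻ_) (ψ-π̄ a b) π∣π̄)
    ... | inj₂ p∣b = p∤b p∣b
    ... | inj₁ p∣2a with euclid pr (+ 2) a p∣2a
    ...   | inj₁ p∣2 = p∤2 p∣2
    ...   | inj₂ p∣a = p∤a p∣a

    -- ψ(z) ψ(z̄) ≡ b² N(z) modulo p, so π∣ z forces p ∣ N z.
    π∤-norm : ∀ z → ¬ p ∣ᶻ N z → ¬ π∣ z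
    π∤-norm (x , y) p∤Nz π∣z with euclid pr (b * b) (N (x , y)) p∣b²Nz
      where
      p∣b²Nz : p ∣ᶻ b * b * N (x , y)
      p∣b²Nz = subst (p ∣ᶻ_) (conjugate-product a b x y)
        (∣m∣n⇒∣m+n (∣m⇒∣m*n (b * x + a * y) π∣z) (subst (λ t → p ∣ᶻ t * (y * y)) (sym p≡a²+b²) (∣m⇒∣m*n (y * y) p∣p)))
    ... | inj₂ p∣Nz = p∤Nz p∣Nz
    ... | inj₁ p∣b² with euclid pr b b p∣b²
    ...   | inj₁ p∣b = p∤b p∣b
    ...   | inj₂ p∣b = p∤b p∣b

    π∤π̄^ : ∀ n → ¬ π∣ (π̄ ^ n)
    π∤π̄^ zero π∣1 = p∤b (subst (p ∣ᶻ_) (ψ-1 a b) π∣1)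
    π∤π̄^ (suc n) = π∤-· π̄ (π̄ ^ n) π∤π̄ (π∤π̄^ n)

module DivisorCount where

  open import Data.Nat
  open import Data.Nat.Properties
  open import Data.Nat.Induction using (<-rec)
  open import Data.Nat.Divisibility using (_∣_; _∣?_; divides; ∣⇒≤; ∣-trans; ∣-refl; n∣m*n; m∣m*n; *-cancelˡ-∣; 0∣⇒≡0)
  open import Data.Nat.Coprimality using (Coprime; coprime-divisor)
  open import Data.Nat.Primality using (Prime; prime⇒irreducible)
  open import Data.List using (List; _∷_; filter; upTo; map; lookup)
  open import Data.List.Membership.Propositional using (_∈_)
  open import Data.List.Membership.Propositional.Properties using (∈-filter⁺; ∈-filter⁻; ∈-upTo⁺; ∈-map⁺; ∈-map⁻; ∈-lookup)
  open import Data.List.Relation.Unary.Any using (index)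
  open import Data.List.Relation.Unary.Any.Properties using (lookup-index)
  import Data.List.Relation.Unary.All as All
  open import Data.List.Relation.Unary.AllPairs using (_∷_)
  open import Data.List.Relation.Unary.Unique.Propositional using (Unique)
  open import Data.List.Relation.Unary.Unique.Propositional.Properties using (filter⁺; upTo⁺; map⁺)
  open import Data.Fin using (Fin; zero; suc; fromℕ<; combine; toℕ)
  import Data.Fin.Properties as Fin
  open import Data.Product using (_,_; _×_)
  open import Data.Sum using (inj₁; inj₂)
  open import Relation.Binary.PropositionalEquality
  open import Relation.Nullary using (¬_; yes; no)
  open import Relation.Nullary.Negation using (contradiction)
  open import Data.Empty using (⊥-elim)
  open import Defs using (τ)
  open PrimeFacts using (prime>1)

  divisors : ℕ → List ℕ
  divisors R = filter (_∣? R) (map suc (upTo R))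

  divisors-unique : ∀ R → Unique (divisors R)
  divisors-unique R = filter⁺ (_∣? R) (map⁺ suc-injective (upTo⁺ R))

  ∈-divisors⁺ : ∀ {R d} → 0 < R → d ∣ R → d ∈ divisors R
  ∈-divisors⁺ {suc R} {zero} _ 0∣R = contradiction (0∣⇒≡0 0∣R) (λ ())
  ∈-divisors⁺ {suc R} {suc d} _ d∣R = ∈-filter⁺ (_∣? suc R) (∈-map⁺ suc (∈-upTo⁺ (∣⇒≤ d∣R))) d∣R

  ∈-divisors⁻ : ∀ {R d} → d ∈ divisors R → d ∣ R × 0 < d
  ∈-divisors⁻ {R} m with ∈-filter⁻ (_∣? R) {xs = map suc (upTo R)} m
  ... | m′ , d∣R with ∈-map⁻ suc m′
  ...   | _ , _ , refl = d∣R , s≤s z≤n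

  divisor : ∀ R → Fin (τ R) → ℕ
  divisor R = lookup (divisors R)

  divisor-index : ∀ {R d} → d ∈ divisors R → Fin (τ R)
  divisor-index = index

  divisor-index-injective : ∀ {R d d′} (m : d ∈ divisors R) (m′ : d′ ∈ divisors R) →
                            divisor-index {R} m ≡ divisor-index {R} m′ → d ≡ d′
  divisor-index-injective {R} m m′ eq = trans (lookup-index m) (trans (cong (divisor R) eq) (sym (lookup-index m′)))

  lookup-injective : ∀ {A : Set} (xs : List A) → Unique xs → ∀ i j → lookup xs i ≡ lookup xs j → i ≡ j
  lookup-injective (x ∷ xs) u zero zero _ = refl
  lookup-injective (x ∷ xs) (x∉ ∷ _) zero (suc j) e = ⊥-elim (All.lookup x∉ (∈-lookup j) e)
  lookup-injective (x ∷ xs) (x∉ ∷ _) (suc i) zero e = ⊥-elim (All.lookup x∉ (∈-lookup i) (sym e))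
  lookup-injective (x ∷ xs) (_ ∷ u) (suc i) (suc j) e = cong suc (lookup-injective xs u i j e)

  divisor-injective : ∀ R i j → divisor R i ≡ divisor R j → i ≡ j
  divisor-injective R = lookup-injective (divisors R) (divisors-unique R)

  -- R > 1 has the two distinct divisors 1 and R.
  τ≥2 : ∀ R → 1 < R → 2 ≤ τ R
  τ≥2 R R>1 = Fin.injective⇒≤ {f = pick} pick-injective
    where
    R>0 : 0 < R
    R>0 = <-trans (s≤s z≤n) R>1
    1∈ : 1 ∈ divisors R
    1∈ = ∈-divisors⁺ R>0 (divides R (sym (*-identityʳ R)))
    R∈ : R ∈ divisors R
    R∈ = ∈-divisors⁺ R>0 ∣-refl
    pick : Fin 2 → Fin (τ R)
    pick zero = divisor-index {R} 1∈
    pick (suc zero) = divisor-index {R} R∈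
    distinct : divisor-index {R} 1∈ ≢ divisor-index {R} R∈
    distinct e = <⇒≢ R>1 (divisor-index-injective {R} 1∈ R∈ e)
    pick-injective : ∀ {x y} → pick x ≡ pick y → x ≡ y
    pick-injective {zero} {zero} _ = refl
    pick-injective {suc zero} {suc zero} _ = refl
    pick-injective {zero} {suc zero} e = ⊥-elim (distinct e)
    pick-injective {suc zero} {zero} e = ⊥-elim (distinct (sym e))

  record Split (p d : ℕ) : Set where
    field
      v d′ : ℕ
      d≡ : d ≡ p ^ v * d′
      p∤d′ : ¬ p ∣ d′
      d′>0 : 0 < d′

  split : ∀ {p} → Prime p → ∀ d → 0 < d → Split p d
  split {p} pr = <-rec (λ d → 0 < d → Split p d) step
    where
    step : ∀ d → (∀ {q} → q < d → 0 < q → Split p q) → 0 < d → Split p d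
    step d rec d>0 with p ∣? d
    ... | no p∤d = record { v = 0 ; d′ = d ; d≡ = sym (+-identityʳ d) ; p∤d′ = p∤d ; d′>0 = d>0 }
    ... | yes (divides q d≡qp) = record
      { v = suc v ; d′ = d′ ; d≡ = trans d≡qp (trans (cong (_* p) d≡) (regroup (p ^ v) d′)) ; p∤d′ = p∤d′ ; d′>0 = d′>0 }
      where
      q>0 : 0 < q
      q>0 = n≢0⇒n>0 (λ q≡0 → <⇒≢ d>0 (sym (trans d≡qp (cong (_* p) q≡0))))
      q<d : q < d
      q<d = subst (q <_) (sym d≡qp) (m<m*n q p {{>-nonZero q>0}} (prime>1 pr))
      open Split (rec q<d q>0)
      regroup : ∀ a b → a * b * p ≡ p * a * b
      regroup a b = trans (*-comm (a * b) p) (sym (*-assoc p a b))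

  -- τ(p^k m) ≤ (k + 1) τ(m) for p ∤ m: a divisor p^v d′ of p^k m has v ≤ k and
  -- d′ ∣ m, and it is determined by the pair (v , d′).
  module _ {p : ℕ} (pr : Prime p) {m : ℕ} (m>0 : 0 < m) (p∤m : ¬ p ∣ m) (k : ℕ) where

    private
      R : ℕ
      R = p ^ k * m

      p^>0 : ∀ k → 0 < p ^ k
      p^>0 k = m^n>0 p {{>-nonZero (<-trans (s≤s z≤n) (prime>1 pr))}} k

      coprime : ∀ {d} → ¬ p ∣ d → Coprime d p
      coprime p∤d {i} (i∣d , i∣p) with prime⇒irreducible pr i∣p
      ... | inj₁ i≡1 = i≡1
      ... | inj₂ refl = ⊥-elim (p∤d i∣d)

      ∣m-part : ∀ j {d′} → Coprime d′ p → d′ ∣ p ^ j * m → d′ ∣ m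
      ∣m-part zero {d′} c h = subst (d′ ∣_) (+-identityʳ m) h
      ∣m-part (suc j) {d′} c h = ∣m-part j c (coprime-divisor c (subst (d′ ∣_) (*-assoc p (p ^ j) m) h))

      -- p^(k+1+t) d′ ∣ p^k m would give p ∣ m
      exponent-bound : ∀ v d′ → p ^ v * d′ ∣ R → v ≤ k
      exponent-bound v d′ h with v ≤? k
      ... | yes v≤k = v≤k
      ... | no v≰k with m≤n⇒∃[o]m+o≡n (≰⇒> v≰k)
      ...   | t , refl = ⊥-elim (p∤m (∣-trans (m∣m*n (p ^ t * d′))
                (*-cancelˡ-∣ (p ^ k) {{>-nonZero (p^>0 k)}} (subst (_∣ R) (regroup t d′) h))))
        where
        regroup : ∀ t d′ → p ^ (suc k + t) * d′ ≡ p ^ k * (p * (p ^ t * d′))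
        regroup t d′ = trans (cong (λ z → p * z * d′) (^-distribˡ-+-* p k t))
          (trans (*-assoc p (p ^ k * p ^ t) d′) (trans (cong (p *_) (*-assoc (p ^ k) (p ^ t) d′))
          (trans (sym (*-assoc p (p ^ k) (p ^ t * d′))) (trans (cong (_* (p ^ t * d′)) (*-comm p (p ^ k)))
            (*-assoc (p ^ k) p (p ^ t * d′))))))

      record Coordinates (i : Fin (τ R)) : Set where
        field
          v d′ : ℕ
          d≡ : divisor R i ≡ p ^ v * d′
          v≤k : v ≤ k
          d′∈ : d′ ∈ divisors m

      coordinates : ∀ i → Coordinates i
      coordinates i with ∈-divisors⁻ {R} (∈-lookup {xs = divisors R} i)
      ... | d∣R , d>0 with split pr (divisor R i) d>0
      ...   | record { v = v ; d′ = d′ ; d≡ = d≡ ; p∤d′ = p∤d′ } = record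
        { v = v ; d′ = d′ ; d≡ = d≡
        ; v≤k = exponent-bound v d′ (subst (_∣ R) d≡ d∣R)
        ; d′∈ = ∈-divisors⁺ m>0 (∣m-part k (coprime p∤d′) (∣-trans (n∣m*n (p ^ v)) (subst (_∣ R) d≡ d∣R))) }

      encode : Fin (τ R) → Fin (suc k * τ m)
      encode i = combine (fromℕ< (s≤s (Coordinates.v≤k (coordinates i)))) (divisor-index {m} (Coordinates.d′∈ (coordinates i)))

      encode-injective : ∀ {i j} → encode i ≡ encode j → i ≡ j
      encode-injective {i} {j} e with Fin.combine-injective
        (fromℕ< (s≤s (Coordinates.v≤k (coordinates i)))) (divisor-index {m} (Coordinates.d′∈ (coordinates i)))
        (fromℕ< (s≤s (Coordinates.v≤k (coordinates j)))) (divisor-index {m} (Coordinates.d′∈ (coordinates j))) e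
      ... | e₁ , e₂ = divisor-injective R i j (trans (C.d≡ ci) (trans (cong₂ (λ a b → p ^ a * b) same-v same-d′) (sym (C.d≡ cj))))
        where
        module C = Coordinates
        ci : Coordinates i
        ci = coordinates i
        cj : Coordinates j
        cj = coordinates j
        same-v : C.v ci ≡ C.v cj
        same-v = trans (sym (Fin.toℕ-fromℕ< (s≤s (C.v≤k ci)))) (trans (cong toℕ e₁) (Fin.toℕ-fromℕ< (s≤s (C.v≤k cj))))
        same-d′ : C.d′ ci ≡ C.d′ cj
        same-d′ = divisor-index-injective {m} (C.d′∈ ci) (C.d′∈ cj) e₂

    τ-bound : τ (p ^ k * m) ≤ suc k * τ m
    τ-bound = Fin.injective⇒≤ {f = encode} encode-injective

module NonAssociates where

  open import Data.Nat as ℕ using (ℕ; zero; suc; _≤_; _<_; _∸_)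
  import Data.Nat.Properties as ℕP
  open import Data.Integer as ℤ using (ℤ; +_; _+_; _*_)
  import Data.Integer.Properties as ℤP
  open import Data.Fin using (Fin; zero; toℕ; remQuot; combine; inject≤)
  import Data.Fin.Properties as Fin
  open import Data.Product using (_,_; proj₁; proj₂; uncurry)
  open import Data.Sum using (inj₁; inj₂)
  open import Relation.Binary.Definitions using (tri<; tri≈; tri>)
  open import Relation.Binary.PropositionalEquality
  open import Relation.Nullary using (¬_)
  open import Relation.Nullary.Negation using (contradiction)
  open import Data.Empty using (⊥-elim)
  open import Data.Nat.Primality using (Prime)
  open Gaussian
  open DivisibilityByπ

  record NonAssociates (R n : ℕ) : Set where
    field
      γ : Fin n → ℤ[i]
      norm : ∀ i → N (γ i) ≡ + R
      distinct : ∀ i j → Assoc (γ i) (γ j) → i ≡ j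

  restrict : ∀ {R n n′} → n ≤ n′ → NonAssociates R n′ → NonAssociates R n
  restrict n≤n′ F = record
    { γ = λ i → γ (inject≤ i n≤n′)
    ; norm = λ i → norm (inject≤ i n≤n′)
    ; distinct = λ i j a → Fin.inject≤-injective n≤n′ n≤n′ i j (distinct _ _ a) }
    where open NonAssociates F

  family-1 : NonAssociates 1 1
  family-1 = record { γ = λ _ → 1ᵍ ; norm = λ _ → refl ; distinct = λ { zero zero _ → refl } }

  -- From a family of size n for m (p ∤ m) and π = a + bi of norm p, the elements
  -- π^e π̄^(k-e) γⱼ (e ≤ k) form a family of size (k + 1) n for p^k m. Elements with
  -- different e are told apart by the exact power of π dividing them; elements
  -- with equal e by cancelling π^e π̄^(k-e).
  module PrimePowerStep (p : ℕ) (pr : Prime p) (a b : ℤ) (p≡a²+b² : a * a + b * b ≡ + p)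
                        (p∤a : ¬ p ∣ᶻ a) (p∤b : ¬ p ∣ᶻ b) (p∤2 : ¬ p ∣ᶻ + 2)
                        {m n : ℕ} (F : NonAssociates m n) (p∤m : ¬ p ∣ᶻ + m) (k : ℕ) where

    open Criterion p pr a b p≡a²+b² p∤a p∤b p∤2
    open NonAssociates F

    private
      Nπ : N π ≡ + p
      Nπ = p≡a²+b²

      Nπ̄ : N π̄ ≡ + p
      Nπ̄ = trans (N-conj π) p≡a²+b²

      N^≢0 : ∀ z e → N z ≡ + p → N (z ^ e) ≢ + 0
      N^≢0 z e Nz≡p eq = contradiction (ℤP.+-injective (ℤP.i^n≡0⇒i≡0 (+ p) e
                           (trans (sym (cong (ℤ._^ e) Nz≡p)) (trans (sym (N-^ z e)) eq))))
                           (λ p≡0 → subst (λ t → ¬ Prime t) (sym p≡0) (λ ()) pr)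

      pos-^ : ∀ n → (+ p) ℤ.^ n ≡ + (p ℕ.^ n)
      pos-^ zero = refl
      pos-^ (suc n) = trans (cong (+ p *_) (pos-^ n)) (sym (ℤP.pos-* p (p ℕ.^ n)))

      element : ℕ → Fin n → ℤ[i]
      element e j = π ^ e · (π̄ ^ (k ∸ e) · γ j)

      element-norm : ∀ e j → e ≤ k → N (element e j) ≡ + (p ℕ.^ k ℕ.* m)
      element-norm e j e≤k = begin
        N (element e j)                                      ≡⟨ N-· (π ^ e) _ ⟩
        N (π ^ e) * N (π̄ ^ (k ∸ e) · γ j)                    ≡⟨ cong (N (π ^ e) *_) (N-· (π̄ ^ (k ∸ e)) (γ j)) ⟩
        N (π ^ e) * (N (π̄ ^ (k ∸ e)) * N (γ j))              ≡⟨ cong₂ (λ u v → u * (v * N (γ j)))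
                                                                  (trans (N-^ π e) (cong (ℤ._^ e) Nπ))
                                                                  (trans (N-^ π̄ (k ∸ e)) (cong (ℤ._^ (k ∸ e)) Nπ̄)) ⟩
        (+ p) ℤ.^ e * ((+ p) ℤ.^ (k ∸ e) * N (γ j))          ≡⟨ cong (λ t → (+ p) ℤ.^ e * ((+ p) ℤ.^ (k ∸ e) * t)) (norm j) ⟩
        (+ p) ℤ.^ e * ((+ p) ℤ.^ (k ∸ e) * + m)              ≡⟨ sym (ℤP.*-assoc ((+ p) ℤ.^ e) _ _) ⟩
        (+ p) ℤ.^ e * (+ p) ℤ.^ (k ∸ e) * + m                ≡⟨ cong (_* + m) (sym (ℤP.^-distribˡ-+-* (+ p) e (k ∸ e))) ⟩
        (+ p) ℤ.^ (e ℕ.+ (k ∸ e)) * + m                      ≡⟨ cong (λ t → (+ p) ℤ.^ t * + m) (ℕP.m+[n∸m]≡n e≤k) ⟩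
        (+ p) ℤ.^ k * + m                                    ≡⟨ cong (_* + m) (pos-^ k) ⟩
        + (p ℕ.^ k) * + m                                    ≡⟨ sym (ℤP.pos-* (p ℕ.^ k) m) ⟩
        + (p ℕ.^ k ℕ.* m)                                    ∎
        where open ≡-Reasoning

      -- if e < e′, cancelling π^e leaves π̄^(k-e) γⱼ, which is not divisible by π,
      -- associated to a multiple of π
      different-exponents : ∀ e e′ j j′ → e < e′ → ¬ Assoc (element e j) (element e′ j′)
      different-exponents e _ j j′ e<e′ assoc with ℕP.m≤n⇒∃[o]m+o≡n e<e′
      ... | t , refl = π∤-· (π̄ ^ (k ∸ e)) (γ j) (π∤π̄^ (k ∸ e)) π∤γⱼ
                         (subst π∣ (sym (trans α≡uπW (·-exchange u π W))) (π∣-multiple (u · W)))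
        where
        π∤γⱼ : ¬ π∣ (γ j)
        π∤γⱼ = π∤-norm (γ j) (λ p∣Nγ → p∤m (subst (p ∣ᶻ_) (norm j) p∣Nγ))
        Y W : ℤ[i]
        Y = π̄ ^ (k ∸ suc (e ℕ.+ t)) · γ j′
        W = π ^ t · Y
        regroup : element (suc e ℕ.+ t) j′ ≡ π ^ e · (π · W)
        regroup = begin
          π ^ (suc e ℕ.+ t) · Y                ≡⟨ cong (λ s → π ^ s · Y) (sym (ℕP.+-suc e t)) ⟩
          π ^ (e ℕ.+ suc t) · Y                ≡⟨ cong (_· Y) (^-+ π e (suc t)) ⟩
          (π ^ e · (π · π ^ t)) · Y            ≡⟨ ·-assoc (π ^ e) (π · π ^ t) Y ⟩
          π ^ e · ((π · π ^ t) · Y)            ≡⟨ cong (π ^ e ·_) (·-assoc π (π ^ t) Y) ⟩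
          π ^ e · (π · W)                      ∎
          where open ≡-Reasoning
        cancelled : Assoc (π̄ ^ (k ∸ e) · γ j) (π · W)
        cancelled = assoc-cancel (π ^ e) (π̄ ^ (k ∸ e) · γ j) (π · W) (N^≢0 π e Nπ)
                      (subst (Assoc (element e j)) regroup assoc)
        u : ℤ[i]
        u = proj₁ cancelled
        α≡uπW : π̄ ^ (k ∸ e) · γ j ≡ u · (π · W)
        α≡uπW = proj₂ (proj₂ cancelled)

      same-exponent : ∀ e j j′ → Assoc (element e j) (element e j′) → j ≡ j′
      same-exponent e j j′ assoc = distinct j j′ (assoc-cancel (π ^ e · π̄ ^ (k ∸ e)) (γ j) (γ j′) N≢0
        (subst₂ Assoc (sym (·-assoc (π ^ e) _ (γ j))) (sym (·-assoc (π ^ e) _ (γ j′))) assoc))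
        where
        N≢0 : N (π ^ e · π̄ ^ (k ∸ e)) ≢ + 0
        N≢0 eq with ℤP.i*j≡0⇒i≡0∨j≡0 (N (π ^ e)) (trans (sym (N-· (π ^ e) _)) eq)
        ... | inj₁ z = N^≢0 π e Nπ z
        ... | inj₂ z = N^≢0 π̄ (k ∸ e) Nπ̄ z

      γ′ : Fin (suc k ℕ.* n) → ℤ[i]
      γ′ x = element (toℕ (proj₁ (remQuot {suc k} n x))) (proj₂ (remQuot {suc k} n x))

      distinct′ : ∀ x y → Assoc (γ′ x) (γ′ y) → x ≡ y
      distinct′ x y assoc = compare (remQuot {suc k} n x) (remQuot {suc k} n y) refl refl assoc
        where
        compare : ∀ r s → remQuot {suc k} n x ≡ r → remQuot {suc k} n y ≡ s →
                  Assoc (element (toℕ (proj₁ r)) (proj₂ r)) (element (toℕ (proj₁ s)) (proj₂ s)) → x ≡ y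
        compare (e , j) (e′ , j′) x≡ y≡ assoc′ with ℕP.<-cmp (toℕ e) (toℕ e′)
        ... | tri< lt _ _ = ⊥-elim (different-exponents (toℕ e) (toℕ e′) j j′ lt assoc′)
        ... | tri> _ _ gt = ⊥-elim (different-exponents (toℕ e′) (toℕ e) j′ j gt (assoc-sym _ _ assoc′))
        ... | tri≈ _ e≡e′ _ = trans (sym (Fin.combine-remQuot {suc k} n x))
               (trans (cong (uncurry combine) (trans x≡ (trans (cong₂ _,_ (Fin.toℕ-injective e≡e′) j≡j′) (sym y≡))))
                 (Fin.combine-remQuot {suc k} n y))
          where
          j≡j′ : j ≡ j′
          j≡j′ = same-exponent (toℕ e) j j′ (subst (λ t → Assoc (element (toℕ e) j) (element t j′)) (sym e≡e′) assoc′)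

    family : NonAssociates (p ℕ.^ k ℕ.* m) (suc k ℕ.* n)
    family = record
      { γ = γ′
      ; norm = λ x → element-norm _ _ (Fin.toℕ≤pred[n] (proj₁ (remQuot {suc k} n x)))
      ; distinct = distinct′ }

module Construction where

  open import Data.Nat
  open import Data.Nat.Properties
  open import Data.Nat.Induction using (<-rec)
  open import Data.Nat.Divisibility using (_∣_; divides; ∣⇒≤; ∣-trans; n∣m*n)
  open import Data.Nat.Primality using (Prime)
  open import Data.Nat.Primality.Factorisation using (factorise)
  open import Data.Nat.DivMod using (_%_)
  open import Data.Nat.ListAction using (product)
  open import Data.List using ([]; _∷_)
  open import Data.List.Relation.Unary.All using (_∷_)
  open import Data.Integer as ℤ using (+_)
  import Data.Integer.Properties as ℤP
  open import Data.Integer.Divisibility.Signed using (∣⇒∣ᵤ)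
  open import Data.Product using (∃; _,_; _×_; proj₁; proj₂)
  open import Relation.Binary.PropositionalEquality
  open import Relation.Nullary using (¬_; yes; no)
  open import Relation.Nullary.Negation using (contradiction)
  open import Data.Empty using (⊥-elim)
  open import Defs using (τ; AllPrimeFactors1mod4)
  open PrimeFacts using (prime>1; prime≢square)
  open TwoSquares using (fermat)
  open DivisibilityByπ using (_∣ᶻ_)
  open DivisorCount using (split; τ-bound)
  open NonAssociates

  prime-divisor : ∀ R → 1 < R → ∃ λ p → Prime p × p ∣ R
  prime-divisor R R>1 with factorise R {{>-nonZero (<-trans (s≤s z≤n) R>1)}}
  ... | record { factors = [] ; isFactorisation = R≡1 } = ⊥-elim (<⇒≢ R>1 (sym R≡1))
  ... | record { factors = p ∷ ps ; isFactorisation = R≡ ; factorsPrime = prime-p ∷ _ } =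
          p , prime-p , divides (product ps) (trans R≡ (*-comm p (product ps)))

  -- In p = a² + b² with p prime, 0 < a < p (b = 0 would make p a square), so p ∤ a.
  square-summand-coprime : ∀ {p} → Prime p → ∀ a b → a * a + b * b ≡ p → ¬ p ∣ᶻ + a
  square-summand-coprime {p} pr a b e p∣a = <⇒≱ a<p (∣⇒≤ {{>-nonZero a>0}} (∣⇒∣ᵤ p∣a))
    where
    b>0 : 0 < b
    b>0 = n≢0⇒n>0 (λ { refl → prime≢square pr a (trans (sym e) (+-identityʳ (a * a))) })
    a>0 : 0 < a
    a>0 = n≢0⇒n>0 (λ { refl → prime≢square pr b (sym e) })
    a<p : a < p
    a<p = ≤-trans (s≤s (m≤m*n a a {{>-nonZero a>0}}))
            (subst (suc (a * a) ≤_) e (subst (_≤ a * a + b * b) (+-comm (a * a) 1)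
              (+-monoʳ-≤ (a * a) (≤-trans b>0 (m≤m*n b b {{>-nonZero b>0}})))))

  -- Strong induction on R: split off the p-part p^v of a prime divisor p, write
  -- p = a² + b² (Fermat), and extend the family for R / p^v by `PrimePowerStep`;
  -- the sizes keep up with τ because τ(p^v m) ≤ (v + 1) τ(m).
  non-associates : ∀ R → 0 < R → AllPrimeFactors1mod4 R → ∃ λ n → τ R ≤ n × NonAssociates R n
  non-associates = <-rec (λ R → 0 < R → AllPrimeFactors1mod4 R → ∃ λ n → τ R ≤ n × NonAssociates R n) step
    where
    step : ∀ R → (∀ {m} → m < R → 0 < m → AllPrimeFactors1mod4 m → ∃ λ n → τ m ≤ n × NonAssociates m n) →
           0 < R → AllPrimeFactors1mod4 R → ∃ λ n → τ R ≤ n × NonAssociates R n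
    step R rec R>0 hyp with 1 <? R
    step (suc zero) rec R>0 hyp | no _ = 1 , ≤-refl , family-1
    step (suc (suc R)) rec R>0 hyp | no R≯1 = ⊥-elim (R≯1 (s≤s (s≤s z≤n)))
    step R rec R>0 hyp | yes R>1 with prime-divisor R R>1
    ... | p , pr , p∣R with split pr R R>0
    ...   | record { v = v ; d′ = m ; d≡ = R≡p^vm ; p∤d′ = p∤m ; d′>0 = m>0 } with fermat p pr (hyp p pr p∣R)
    ...     | a , b , p≡a²+b² = suc v * n , bound , subst (λ t → NonAssociates t (suc v * n)) (sym R≡p^vm) extended
      where
      v>0 : 0 < v
      v>0 = n≢0⇒n>0 (λ { refl → p∤m (subst (p ∣_) (trans R≡p^vm (+-identityʳ m)) p∣R) })
      m<R : m < R
      m<R = subst (m <_) (trans (*-comm m (p ^ v)) (sym R≡p^vm))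
              (m<m*n m (p ^ v) {{>-nonZero m>0}} (^-monoʳ-< p (prime>1 pr) v>0))
      IH : ∃ λ n → τ m ≤ n × NonAssociates m n
      IH = rec m<R m>0 (λ q q-prime q∣m → hyp q q-prime (subst (q ∣_) (sym R≡p^vm) (∣-trans q∣m (n∣m*n (p ^ v)))))
      n : ℕ
      n = proj₁ IH
      p∤2 : ¬ p ∣ᶻ + 2
      p∤2 p∣2 = <⇒≱ (prime>1 pr) (≤-pred (≤∧≢⇒< (∣⇒≤ (∣⇒∣ᵤ p∣2))
        (λ p≡2 → contradiction (trans (cong (_% 4) (sym p≡2)) (hyp p pr p∣R)) (λ ()))))
      p≡a²+b²ᶻ : + a ℤ.* + a ℤ.+ + b ℤ.* + b ≡ + p
      p≡a²+b²ᶻ = trans (cong₂ ℤ._+_ (sym (ℤP.pos-* a a)) (sym (ℤP.pos-* b b)))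
                   (trans (sym (ℤP.pos-+ (a * a) (b * b))) (cong +_ p≡a²+b²))
      extended : NonAssociates (p ^ v * m) (suc v * n)
      extended = PrimePowerStep.family p pr (+ a) (+ b) p≡a²+b²ᶻ
        (square-summand-coprime pr a b p≡a²+b²) (square-summand-coprime pr b a (trans (+-comm (b * b) (a * a)) p≡a²+b²))
        p∤2 (proj₂ (proj₂ IH)) (λ p∣m → p∤m (∣⇒∣ᵤ p∣m)) v
      bound : τ R ≤ suc v * n
      bound = subst (λ t → τ t ≤ suc v * n) (sym R≡p^vm)
                (≤-trans (τ-bound pr m>0 p∤m v) (*-monoʳ-≤ (suc v) (proj₁ (proj₂ IH))))

  τ-non-associates : ∀ R → 0 < R → AllPrimeFactors1mod4 R → NonAssociates R (τ R)
  τ-non-associates R R>0 hyp with non-associates R R>0 hyp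
  ... | _ , τ≤n , F = restrict τ≤n F

module CirclePoints where

  open import Data.Nat as ℕ using (ℕ; zero; suc; _≤_; z≤n; s≤s)
  import Data.Nat.Properties as ℕP
  open import Data.Integer as ℤ using (ℤ; +_; -_; _+_; _-_; _*_; ∣_∣)
  import Data.Integer.Properties as ℤP
  open import Data.Fin using (Fin; zero; suc; remQuot; combine; fromℕ<; toℕ)
  import Data.Fin.Properties as Fin
  open import Data.Product using (∃-syntax; _,_; _×_; proj₁; proj₂; uncurry)
  open import Data.Sum using (inj₁; inj₂)
  open import Relation.Binary.PropositionalEquality
  open import Relation.Nullary using (¬_)
  open import Relation.Nullary.Negation using (contradiction)
  open import Data.Empty using (⊥-elim)
  open import Data.Integer.Tactic.RingSolver using (solve-∀)
  open import Defs using (Point; dist²; Collinear; IntegralDistance; OnCircleRadiusHalf)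
  open Gaussian
  open NonAssociates using (NonAssociates)

  -- For R = 2ρ + 1 and γ = a + bi of norm R, the lattice point
  --   point γ = (ρ + 1 - b² , ab) = (1 + γ²) / 2
  -- lies on the circle of radius R/2 around (1/2 , 0), and two such points are
  -- at distance |cross γ δ|, since |γ² - δ²| = 2 |cross γ δ| when |γ| = |δ|.
  point : ℤ → ℤ[i] → Point
  point ρ (a , b) = (ρ + + 1 - b * b , a * b)

  -- Polynomial identities behind the lemmas below; the first three hold up to a
  -- multiple of a difference of norms.
  abstract
    on-circle-identity : ∀ ρ a b → + 4 * ((+ 2 * (ρ + + 1 - b * b) - + 1) * (+ 2 * (ρ + + 1 - b * b) - + 1) + (+ 2 * (a * b) - + 0) * (+ 2 * (a * b) - + 0))
                                   ≡ + 4 * ((+ 2 * ρ + + 1) * (+ 2 * ρ + + 1)) + (a * a + b * b - (+ 2 * ρ + + 1)) * (+ 16 * (b * b))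
    on-circle-identity = solve-∀

    distance-identity : ∀ ρ a b c d →
      ((ρ + + 1 - b * b) - (ρ + + 1 - d * d)) * ((ρ + + 1 - b * b) - (ρ + + 1 - d * d)) + (a * b - c * d) * (a * b - c * d)
        ≡ (a * d - b * c) * (a * d - b * c) + (a * a + b * b - (c * c + d * d)) * (b * b - d * d)
    distance-identity = solve-∀

    collinearity-identity : ∀ ρ a b c d →
      ((ρ + + 1 - a * a) - (ρ + + 1 - b * b)) * (c * d - a * b) - ((- b) * a - a * b) * ((ρ + + 1 - d * d) - (ρ + + 1 - b * b))
        ≡ - ((a * c - b * (- d)) * (a * d - b * c)) + (a * a + b * b - (c * c + d * d)) * (a * b)
    collinearity-identity = solve-∀

    cross-rotate-self : ∀ a b → a * a - b * (- b) ≡ a * a + b * b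
    cross-rotate-self = solve-∀

    cross-self-rotate : ∀ a b → (- b) * b - a * a ≡ - (a * a + b * b)
    cross-self-rotate = solve-∀

    N-rotate-identity : ∀ a b → (- b) * (- b) + a * a ≡ a * a + b * b
    N-rotate-identity = solve-∀

    dist²-self : ∀ x y → (x - x) * (x - x) + (y - y) * (y - y) ≡ + 0
    dist²-self = solve-∀

  drop-multiple : ∀ x y z w → y ≡ z → x + (y - z) * w ≡ x
  drop-multiple x y z w y≡z = trans (cong (λ t → x + t * w) (ℤP.i≡j⇒i-j≡0 y≡z))
                                    (trans (cong (λ t → x + t) (ℤP.*-zeroˡ w)) (ℤP.+-identityʳ x))

  N-rotate : ∀ γ → N (rotate γ) ≡ N γ
  N-rotate (a , b) = N-rotate-identity a b

  module _ (ρ : ℤ) where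

    point-on-circle : ∀ γ → N γ ≡ + 2 * ρ + + 1 →
      let (x , y) = point ρ γ
      in + 4 * ((+ 2 * x - + 1) * (+ 2 * x - + 1) + (+ 2 * y - + 0) * (+ 2 * y - + 0)) ≡ + 4 * ((+ 2 * ρ + + 1) * (+ 2 * ρ + + 1))
    point-on-circle (a , b) Nγ≡T = trans (on-circle-identity ρ a b) (drop-multiple _ _ _ _ Nγ≡T)

    dist²-point : ∀ γ δ → N γ ≡ N δ → dist² (point ρ γ) (point ρ δ) ≡ cross γ δ * cross γ δ
    dist²-point (a , b) (c , d) Nγ≡Nδ = trans (distance-identity ρ a b c d) (drop-multiple _ _ _ _ Nγ≡Nδ)

    -- the triangle point γ, point (iγ), point δ degenerates only if γ δ̄ is real or imaginary
    collinear-point : ∀ γ δ → N γ ≡ N δ → Collinear (point ρ γ) (point ρ (rotate γ)) (point ρ δ) →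
                      cross γ (rotate δ) * cross γ δ ≡ + 0
    collinear-point (a , b) (c , d) Nγ≡Nδ collinear = ℤP.neg-injective
      (trans (sym (drop-multiple (- (X * Y)) (N (a , b)) (N (c , d)) (a * b) Nγ≡Nδ))
        (trans (sym (collinearity-identity ρ a b c d)) (ℤP.i≡j⇒i-j≡0 collinear)))
      where
      X Y : ℤ
      X = cross (a , b) (rotate (c , d))
      Y = cross (a , b) (c , d)

  remQuot-injective : ∀ {m} n {x y : Fin (m ℕ.* n)} → remQuot {m} n x ≡ remQuot {m} n y → x ≡ y
  remQuot-injective {m} n {x} {y} e =
    trans (sym (Fin.combine-remQuot {m} n x)) (trans (cong (uncurry combine) e) (Fin.combine-remQuot {m} n y))

  module PointSet {R n : ℕ} (r : ℕ) (R≡2r+1 : R ≡ suc (2 ℕ.* r)) (F : NonAssociates R n) where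

    open NonAssociates.NonAssociates F

    ρ : ℤ
    ρ = + r

    turn : Fin 2 → ℤ[i] → ℤ[i]
    turn zero γ = γ
    turn (suc zero) γ = rotate γ

    element : Fin 2 × Fin n → ℤ[i]
    element (s , j) = turn s (γ j)

    points : Fin (2 ℕ.* n) → Point
    points x = point ρ (element (remQuot {2} n x))

    private
      R≡2ρ+1 : + R ≡ + 2 * ρ + + 1
      R≡2ρ+1 = trans (cong +_ (trans R≡2r+1 (ℕP.+-comm 1 (2 ℕ.* r))))
                     (trans (ℤP.pos-+ (2 ℕ.* r) 1) (cong (_+ + 1) (ℤP.pos-* 2 r)))

      R≢0 : + R ≢ + 0
      R≢0 R≡0 = contradiction (ℤP.+-injective (trans (cong +_ (sym R≡2r+1)) R≡0)) (λ ())

      N-turn : ∀ s γ → N (turn s γ) ≡ N γ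
      N-turn zero γ = refl
      N-turn (suc zero) γ = N-rotate γ

      N-element : ∀ x → N (element x) ≡ + R
      N-element (s , j) = trans (N-turn s (γ j)) (norm j)

      turn-assoc : ∀ s γ → Assoc (turn s γ) γ
      turn-assoc zero γ = 1ᵍ , refl , sym (·-identityˡ γ)
      turn-assoc (suc zero) γ = rotate-assoc γ

      cross-turn : ∀ s t γ → N γ ≢ + 0 → cross (turn s γ) (turn t γ) ≡ + 0 → s ≡ t
      cross-turn zero zero _ _ _ = refl
      cross-turn (suc zero) (suc zero) _ _ _ = refl
      cross-turn zero (suc zero) (a , b) Nγ≢0 e = ⊥-elim (Nγ≢0 (trans (sym (cross-rotate-self a b)) e))
      cross-turn (suc zero) zero (a , b) Nγ≢0 e =
        ⊥-elim (Nγ≢0 (trans (sym (ℤP.neg-involutive (N (a , b)))) (cong -_ (trans (sym (cross-self-rotate a b)) e))))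

      cross≡0⇒same : ∀ x y → cross (element x) (element y) ≡ + 0 → x ≡ y
      cross≡0⇒same (s , j) (t , j′) e = cong₂ _,_ s≡t j≡j′
        where
        α β : ℤ[i]
        α = turn s (γ j)
        β = turn t (γ j′)
        α~β : Assoc α β
        α~β = cross≡0⇒assoc α β (trans (N-element (s , j)) (sym (N-element (t , j′))))
                               (λ Nβ≡0 → R≢0 (trans (sym (N-element (t , j′))) Nβ≡0)) e
        γⱼ~γⱼ′ : Assoc (γ j) (γ j′)
        γⱼ~γⱼ′ = assoc-trans (γ j) α (γ j′) (assoc-sym α (γ j) (turn-assoc s (γ j)))
                   (assoc-trans α β (γ j′) α~β (turn-assoc t (γ j′)))
        j≡j′ : j ≡ j′
        j≡j′ = distinct j j′ γⱼ~γⱼ′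
        s≡t : s ≡ t
        s≡t = cross-turn s t (γ j) (λ N≡0 → R≢0 (trans (sym (norm j)) N≡0))
                (subst (λ k → cross α (turn t (γ k)) ≡ + 0) (sym j≡j′) e)

    private
      label : Fin (2 ℕ.* n) → ℤ[i]
      label x = element (remQuot {2} n x)

      dist²-points : ∀ x y → dist² (points x) (points y) ≡ cross (label x) (label y) * cross (label x) (label y)
      dist²-points x y = dist²-point ρ (label x) (label y)
                           (trans (N-element (remQuot {2} n x)) (sym (N-element (remQuot {2} n y))))

    points-injective : ∀ {x y} → points x ≡ points y → x ≡ y
    points-injective {x} {y} e = remQuot-injective n (cross≡0⇒same (remQuot {2} n x) (remQuot {2} n y)
      (square≡0 (cross (label x) (label y))
        (trans (sym (dist²-points x y))
               (trans (cong (dist² (points x)) (sym e)) (dist²-self (proj₁ (points x)) (proj₂ (points x)))))))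

    points-integral : ∀ x y → IntegralDistance (points x) (points y)
    points-integral x y = ∣ cross (label x) (label y) ∣ , trans (dist²-points x y) (square≡ (cross (label x) (label y)))

    -- centre (1/2 , 0) = (a/q , b/q) with a = 1, b = 0, q = 2
    points-on-circle : OnCircleRadiusHalf R (2 ℕ.* n) points
    points-on-circle = + 1 , + 0 , 2 , s≤s z≤n , λ x →
      trans (point-on-circle ρ (label x) (trans (N-element (remQuot {2} n x)) R≡2ρ+1))
            (trans (cong (λ t → + 4 * (t * t)) (sym R≡2ρ+1))
                   (sym (trans (ℤP.pos-* 4 (R ℕ.* R)) (cong (+ 4 *_) (ℤP.pos-* R R)))))

    -- for j₀ ≠ j₁, the points of γⱼ₀, iγⱼ₀ and γⱼ₁ form a triangle
    points-non-collinear : 2 ≤ n → ∃[ x ] ∃[ y ] ∃[ z ] ¬ Collinear (points x) (points y) (points z)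
    points-non-collinear 2≤n = combine {2} zero j₀ , combine {2} (suc zero) j₀ , combine {2} zero j₁ , non-collinear
      where
      j₀ j₁ : Fin n
      j₀ = fromℕ< (ℕP.<-trans (s≤s z≤n) 2≤n)
      j₁ = fromℕ< 2≤n
      j₀≢j₁ : j₀ ≢ j₁
      j₀≢j₁ e = contradiction (trans (sym (Fin.toℕ-fromℕ< (ℕP.<-trans (s≤s z≤n) 2≤n)))
                                (trans (cong toℕ e) (Fin.toℕ-fromℕ< 2≤n))) (λ ())
      points-combine : ∀ s j → points (combine {2} s j) ≡ point ρ (turn s (γ j))
      points-combine s j = cong (λ w → point ρ (element w)) (Fin.remQuot-combine {2} {n} s j)
      Nγ₁≢0 : N (γ j₁) ≢ + 0
      Nγ₁≢0 N≡0 = R≢0 (trans (sym (norm j₁)) N≡0)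
      Nγ₀≡Nγ₁ : N (γ j₀) ≡ N (γ j₁)
      Nγ₀≡Nγ₁ = trans (norm j₀) (sym (norm j₁))
      non-collinear : ¬ Collinear (points (combine {2} zero j₀)) (points (combine {2} (suc zero) j₀)) (points (combine {2} zero j₁))
      non-collinear collinear
        with ℤP.i*j≡0⇒i≡0∨j≡0 (cross (γ j₀) (rotate (γ j₁))) (collinear-point ρ (γ j₀) (γ j₁) Nγ₀≡Nγ₁
               (subst₂ (λ P Q → Collinear P Q (point ρ (γ j₁))) (points-combine zero j₀) (points-combine (suc zero) j₀)
                 (subst (Collinear (points (combine {2} zero j₀)) (points (combine {2} (suc zero) j₀))) (points-combine zero j₁) collinear)))
      ... | inj₁ X≡0 = j₀≢j₁ (distinct j₀ j₁ (assoc-trans (γ j₀) (rotate (γ j₁)) (γ j₁)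
              (cross≡0⇒assoc (γ j₀) (rotate (γ j₁)) (trans Nγ₀≡Nγ₁ (sym (N-rotate (γ j₁))))
                             (λ N≡0 → Nγ₁≢0 (trans (sym (N-rotate (γ j₁))) N≡0)) X≡0)
              (rotate-assoc (γ j₁))))
      ... | inj₂ Y≡0 = j₀≢j₁ (distinct j₀ j₁ (cross≡0⇒assoc (γ j₀) (γ j₁) Nγ₀≡Nγ₁ Nγ₁≢0 Y≡0))

open import Defs
open import Data.Nat using (ℕ; zero; suc; _<_; _+_; _*_; z≤n; s≤s)
open import Data.Nat.Properties using (<-trans; *-comm)
open import Data.Nat.DivMod using (_%_; _/_; m≡m%n+[m/n]*n; m%n<n)
open import Data.Nat.Divisibility using (m%n≡0⇒n∣m)
open import Data.Nat.Primality using (prime[2])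
open import Data.Product using (∃-syntax; _×_; _,_)
open import Relation.Binary.PropositionalEquality
open import Relation.Nullary.Negation using (contradiction)
open DivisorCount using (τ≥2)
open Construction using (τ-non-associates)
open CirclePoints using (module PointSet)

-- 2 is not ≡ 1 (mod 4), so such an R is odd.
odd : ∀ R → AllPrimeFactors1mod4 R → R ≡ suc (2 * (R / 2))
odd R hyp = trans (m≡m%n+[m/n]*n R 2) (cong₂ _+_ R%2≡1 (*-comm (R / 2) 2))
  where
  R%2≡1 : R % 2 ≡ 1
  R%2≡1 with R % 2 | m%n<n R 2 | m%n≡0⇒n∣m R 2
  ... | zero | _ | 2∣R = contradiction (hyp 2 prime[2] (2∣R refl)) (λ ())
  ... | suc zero | _ | _ = refl
  ... | suc (suc _) | s≤s (s≤s ()) | _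

mainTheorem5 : (R : ℕ) → 1 < R → AllPrimeFactors1mod4 R →
    ∃[ P ] (IsIntegralPointSet (2 * τ R) P × OnCircleRadiusHalf R (2 * τ R) P)
mainTheorem5 R R>1 hyp =
  points , (points-injective , points-non-collinear (τ≥2 R R>1) , points-integral) , points-on-circle
  where
  open PointSet (R / 2) (odd R hyp) (τ-non-associates R (<-trans (s≤s z≤n) R>1) hyp)
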